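{- Let $n\ge 4$. If $L$ is an integral lattice which represents $D_n$ imprimitively, then $L$ is isometric to $I_n\perp N$ or to $D_n[1]\perp N$ for some integral lattice $N$.
   Context: Lattices are finitely generated $\mathbb{Z}$-modules on positive definite quadratic spaces over $\mathbb{Q}$ with quadratic map $Q$ and bilinear form $B$; integral means $B(L,L)\subseteq\mathbb{Z}$. A representation $\sigma:M\to L$ is a linear map preserving $Q$; it is primitive if $\mathbb{Q}\sigma(M)\cap L=\sigma(M)$, and imprimitive otherwise; $L$ represents $M$ imprimitively if it has an imprimitive representation of $M$. $I_n=\mathbb{Z}^n$ with the standard dot product. $D_n=\{(a_1,\dots,a_n)\in\mathbb{Z}^n: a_1+\dots+a_n\equiv 0 \bmod 2\}$ with the standard dot product, and $D_n[1]=D_n+\mathbb{Z}(1/2,\dots,1/2)$ (integral when $n\equiv 0\bmod 4$). $\perp$ denotes orthogonal sum. -}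

module Defs where

open import Data.Nat as ℕ using (ℕ)
open import Data.Integer using (ℤ; +_; _+_; _*_; _<_)
open import Data.Integer.Divisibility using (_∣_)
open import Data.Vec using (Vec; []; _∷_; zipWith; map; replicate; foldr′; lookup)
open import Data.Fin using (Fin)
open import Data.Product using (Σ; ∃; _×_; _,_; proj₁; proj₂)
open import Relation.Binary.PropositionalEquality using (_≡_; _≢_)
open import Relation.Nullary using (¬_)
open import Data.Unit using (⊤)

Zn : ℕ → Set
Zn n = Vec ℤ n

sumℤ : ∀ {n} → Zn n → ℤ
sumℤ = foldr′ _+_ (+ 0)

dot : ∀ {n} → Zn n → Zn n → ℤ
dot x y = sumℤ (zipWith _*_ x y)

_⊕_ : ∀ {n} → Zn n → Zn n → Zn n
_⊕_ = zipWith _+_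

_·_ : ∀ {n} → ℤ → Zn n → Zn n
c · x = map (c *_) x

0v : ∀ {n} → Zn n
0v {n} = replicate n (+ 0)

1v : ∀ {n} → Zn n
1v {n} = replicate n (+ 1)

Gram : ℕ → Set
Gram m = Vec (Vec ℤ m) m

BG : ∀ {m} → Gram m → Zn m → Zn m → ℤ
BG G x y = dot x (map (λ row → dot row y) G)

-- An integral lattice of rank m, given by its (integral) Gram matrix with
-- respect to a Z-basis; the ambient quadratic space is positive definite.
record IntLattice (m : ℕ) : Set where
  field
    gram      : Gram m
    symmetric : ∀ (i j : Fin m) → lookup (lookup gram i) j ≡ lookup (lookup gram j) i
    posdef    : ∀ (x : Zn m) → x ≢ 0v → + 0 < BG gram x x
open IntLattice public

B : ∀ {m} → IntLattice m → Zn m → Zn m → ℤ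
B L = BG (gram L)

InD : ∀ {n} → Zn n → Set
InD a = + 2 ∣ sumℤ a

-- D_n[1] = D_n + ℤ(1/2,...,1/2), encoded in doubled coordinates:
-- v ∈ ℤ^n encodes v/2, so membership is v = 2a + c(1,...,1) with a ∈ D_n,
-- and the form is (v·w)/4.
InDn1 : ∀ {n} → Zn n → Set
InDn1 {n} v = Σ (Zn n) λ a → Σ ℤ λ c → InD a × (v ≡ ((+ 2) · a) ⊕ (c · 1v))

record Rep (n : ℕ) {m : ℕ} (L : IntLattice m) : Set where
  field
    map-σ : Zn n → Zn m
    additive : ∀ x y → InD x → InD y → map-σ (x ⊕ y) ≡ map-σ x ⊕ map-σ y
    isometric : ∀ x → InD x → B L (map-σ x) (map-σ x) ≡ dot x x
open Rep public

-- σ is imprimitive: (ℚσ(D_n) ∩ L) ≠ σ(D_n), i.e. some y ∈ L with d·y ∈ σ(D_n)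
-- for some integer d ≥ 1, but y ∉ σ(D_n).
Imprimitive : ∀ {n m} {L : IntLattice m} → Rep n L → Set
Imprimitive {n} {m} σ =
  Σ (Zn m) λ y → Σ ℕ λ d → Σ (Zn n) λ x →
    (1 ℕ.≤ d) × InD x × ((+ d) · y ≡ map-σ σ x) ×
    ¬ (Σ (Zn n) λ x′ → InD x′ × map-σ σ x′ ≡ y)

-- L is isometric to C ⊥ N, where C = { v ∈ ℤ^n : P v } with form (v·w)/s.
-- Witnessed by a Z-linear bijection f : L → C × ℤ^k with inverse g such that
-- s·B_L(x,y) = f₁x · f₁y + s·B_N(f₂x, f₂y).
IsometricPerp : ∀ {m} (L : IntLattice m) (n : ℕ) (P : Zn n → Set) (s : ℤ)
                {k : ℕ} (N : IntLattice k) → Set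
IsometricPerp {m} L n P s {k} N =
  Σ (Zn m → Zn n × Zn k) λ f → Σ (Zn n → Zn k → Zn m) λ g →
    (∀ x y → f (x ⊕ y) ≡ (proj₁ (f x) ⊕ proj₁ (f y) , proj₂ (f x) ⊕ proj₂ (f y))) ×
    (∀ x → P (proj₁ (f x))) ×
    (∀ x → g (proj₁ (f x)) (proj₂ (f x)) ≡ x) ×
    (∀ v w → P v → f (g v w) ≡ (v , w)) ×
    (∀ x y → s * B L x y ≡ dot (proj₁ (f x)) (proj₁ (f y)) + s * B N (proj₂ (f x)) (proj₂ (f y)))

IsoIPerp : ∀ {m} (L : IntLattice m) (n : ℕ) {k} (N : IntLattice k) → Set
IsoIPerp L n N = IsometricPerp L n (λ _ → ⊤) (+ 1) N

IsoDn1Perp : ∀ {m} (L : IntLattice m) (n : ℕ) {k} (N : IntLattice k) → Set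
IsoDn1Perp L n N = IsometricPerp L n InDn1 (+ 4) N

-- Put S a = σ(2a): S is additive on all of ℤⁿ and B(S a, S b) = 4 a·b.  If d y = σ x but y ∉ σ(Dₙ),
-- the pairings τᵢ = B(y, S eᵢ) satisfy 4y = S τ and are congruent mod 2 (S eᵢ - S e₀ ∈ 2L).  If they are
-- even then 2y = S s with s ∉ Dₙ, which gives v ∈ L with 2v = S e₀, and then every S eᵢ / 2 lies in L: a
-- copy of Iₙ.  If they are odd then 4y = 2 S s + S 1, which gives w ∈ L with 4w = S(±1, 1, …, 1): a copy
-- of Dₙ[1].  Either copy C is unimodular, so pairing with its frame maps L onto C, with a section, and
-- L = C ⊥ kernel; the kernel gets a ℤ-basis from Euclid's algorithm.
module Submission where

open import Defs
open import Data.Nat as ℕ using (ℕ; zero; suc; _≤_)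
import Data.Nat.Properties as ℕ
import Data.Nat.DivMod as ℕ
open import Data.Integer as ℤ using (ℤ; +_; -_; +[1+_]; -[1+_]; _+_; _*_; _-_; _<_; ∣_∣)
import Data.Integer.Properties as ℤ
open import Data.Integer.DivMod using (_/_; _%_; a≡a%n+[a/n]*n; n%d<d)
import Data.Integer.Divisibility.Signed as Signed
open import Data.Integer.Tactic.RingSolver using (solve-∀)
open import Algebra.Properties.AbelianGroup ℤ.+-0-abelianGroup using (∙-cancelˡ; ∙-cancelʳ)
open import Data.Fin using (Fin; zero; suc)
open import Data.Fin.Properties using (suc-injective)
open import Data.Vec using (Vec; []; _∷_; map; lookup; tabulate; head; tail)
open import Data.Vec.Properties using (zipWith-comm; lookup-map; lookup∘tabulate; tabulate-∘; tabulate-cong)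
open import Data.Product using (Σ; _×_; _,_; proj₁; proj₂; map₂)
open import Data.Sum using (_⊎_; inj₁; inj₂)
open import Data.Unit using (⊤; tt)
open import Data.Empty using (⊥-elim)
open import Relation.Binary.PropositionalEquality
open import Relation.Nullary using (¬_; contradiction)

private variable n k l m : ℕ

-- Integer vectors

neg : Zn n → Zn n
neg = map (-_)

_⊖_ : Zn n → Zn n → Zn n
x ⊖ y = x ⊕ neg y

unit : Fin n → Zn n
unit zero    = + 1 ∷ 0v
unit (suc i) = + 0 ∷ unit i

Additive : (Zn n → Zn m) → Set
Additive F = ∀ x y → F (x ⊕ y) ≡ F x ⊕ F y

lookup-ext : {x y : Zn n} → (∀ i → lookup x i ≡ lookup y i) → x ≡ y
lookup-ext {x = []}    {[]}    _  = refl
lookup-ext {x = a ∷ x} {b ∷ y} eq = cong₂ _∷_ (eq zero) (lookup-ext (λ i → eq (suc i)))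

lookup-⊕ : (x y : Zn n) (j : Fin n) → lookup (x ⊕ y) j ≡ lookup x j + lookup y j
lookup-⊕ (a ∷ x) (b ∷ y) zero    = refl
lookup-⊕ (a ∷ x) (b ∷ y) (suc j) = lookup-⊕ x y j

⊕-comm : (x y : Zn n) → x ⊕ y ≡ y ⊕ x
⊕-comm = zipWith-comm ℤ.+-comm

⊕-identityˡ : (x : Zn n) → 0v ⊕ x ≡ x
⊕-identityˡ []      = refl
⊕-identityˡ (a ∷ x) = cong₂ _∷_ (ℤ.+-identityˡ a) (⊕-identityˡ x)

⊕-identityʳ : (x : Zn n) → x ⊕ 0v ≡ x
⊕-identityʳ x = trans (⊕-comm x 0v) (⊕-identityˡ x)

⊖-self : (x : Zn n) → x ⊖ x ≡ 0v
⊖-self []      = refl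
⊖-self (a ∷ x) = cong₂ _∷_ (ℤ.+-inverseʳ a) (⊖-self x)

⊕-⊖-cancelˡ : (x y : Zn n) → (x ⊕ y) ⊖ x ≡ y
⊕-⊖-cancelˡ []      []      = refl
⊕-⊖-cancelˡ (a ∷ x) (b ∷ y) = cong₂ _∷_ (lemma a b) (⊕-⊖-cancelˡ x y)
  where
  lemma : ∀ a b → (a + b) + - a ≡ b
  lemma = solve-∀

⊖-⊕-cancel : (x y : Zn n) → (x ⊖ y) ⊕ y ≡ x
⊖-⊕-cancel []      []      = refl
⊖-⊕-cancel (a ∷ x) (b ∷ y) = cong₂ _∷_ (lemma a b) (⊖-⊕-cancel x y)
  where
  lemma : ∀ a b → (a + - b) + b ≡ a
  lemma = solve-∀

⊕-⊖-cancelʳ : (x y : Zn n) → y ⊕ (x ⊖ y) ≡ x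
⊕-⊖-cancelʳ x y = trans (⊕-comm y (x ⊖ y)) (⊖-⊕-cancel x y)

⊖-⊖-cancel : (x y : Zn n) → x ⊖ (x ⊖ y) ≡ y
⊖-⊖-cancel []      []      = refl
⊖-⊖-cancel (a ∷ x) (b ∷ y) = cong₂ _∷_ (lemma a b) (⊖-⊖-cancel x y)
  where
  lemma : ∀ a b → a + - (a + - b) ≡ b
  lemma = solve-∀

⊕-⊖-interchange : (x y u v : Zn n) → (x ⊕ y) ⊖ (u ⊕ v) ≡ (x ⊖ u) ⊕ (y ⊖ v)
⊕-⊖-interchange []      []      []      []      = refl
⊕-⊖-interchange (a ∷ x) (b ∷ y) (c ∷ u) (d ∷ v) =
  cong₂ _∷_ (lemma a b c d) (⊕-⊖-interchange x y u v)
  where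
  lemma : ∀ a b c d → (a + b) + - (c + d) ≡ (a + - c) + (b + - d)
  lemma = solve-∀

·-identityˡ : (x : Zn n) → (+ 1) · x ≡ x
·-identityˡ []      = refl
·-identityˡ (a ∷ x) = cong₂ _∷_ (ℤ.*-identityˡ a) (·-identityˡ x)

·-assoc : ∀ c d (x : Zn n) → c · (d · x) ≡ (c * d) · x
·-assoc c d []      = refl
·-assoc c d (a ∷ x) = cong₂ _∷_ (sym (ℤ.*-assoc c d a)) (·-assoc c d x)

·-comm : ∀ c d (x : Zn n) → c · (d · x) ≡ d · (c · x)
·-comm c d x = trans (·-assoc c d x) (trans (cong (_· x) (ℤ.*-comm c d)) (sym (·-assoc d c x)))

·-distrib-⊕ : ∀ c (x y : Zn n) → c · (x ⊕ y) ≡ (c · x) ⊕ (c · y)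
·-distrib-⊕ c []      []      = refl
·-distrib-⊕ c (a ∷ x) (b ∷ y) = cong₂ _∷_ (ℤ.*-distribˡ-+ c a b) (·-distrib-⊕ c x y)

·-distrib-⊖ : ∀ c (x y : Zn n) → c · (x ⊖ y) ≡ (c · x) ⊖ (c · y)
·-distrib-⊖ c []      []      = refl
·-distrib-⊖ c (a ∷ x) (b ∷ y) = cong₂ _∷_ (lemma c a b) (·-distrib-⊖ c x y)
  where
  lemma : ∀ c a b → c * (a + - b) ≡ c * a + - (c * b)
  lemma = solve-∀

·-cancel : ∀ c .{{_ : ℤ.NonZero c}} (x y : Zn n) → c · x ≡ c · y → x ≡ y
·-cancel c []      []      _  = refl
·-cancel c (a ∷ x) (b ∷ y) eq =
  cong₂ _∷_ (ℤ.*-cancelˡ-≡ c a b (cong head eq)) (·-cancel c x y (cong tail eq))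

dot-comm : (x y : Zn n) → dot x y ≡ dot y x
dot-comm []      []      = refl
dot-comm (a ∷ x) (b ∷ y) = cong₂ _+_ (ℤ.*-comm a b) (dot-comm x y)

dot-⊕ˡ : (x y z : Zn n) → dot (x ⊕ y) z ≡ dot x z + dot y z
dot-⊕ˡ []      []      []      = refl
dot-⊕ˡ (a ∷ x) (b ∷ y) (c ∷ z) = trans (cong (_+_ ((a + b) * c)) (dot-⊕ˡ x y z)) (lemma a b c (dot x z) (dot y z))
  where
  lemma : ∀ a b c u v → (a + b) * c + (u + v) ≡ (a * c + u) + (b * c + v)
  lemma = solve-∀

dot-⊕ʳ : (x y z : Zn n) → dot x (y ⊕ z) ≡ dot x y + dot x z
dot-⊕ʳ x y z = trans (dot-comm x (y ⊕ z)) (trans (dot-⊕ˡ y z x) (cong₂ _+_ (dot-comm y x) (dot-comm z x)))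

dot-·ˡ : ∀ c (x y : Zn n) → dot (c · x) y ≡ c * dot x y
dot-·ˡ c []      []      = sym (ℤ.*-zeroʳ c)
dot-·ˡ c (a ∷ x) (b ∷ y) = trans (cong (_+_ (c * a * b)) (dot-·ˡ c x y)) (lemma c a b (dot x y))
  where
  lemma : ∀ c a b u → c * a * b + c * u ≡ c * (a * b + u)
  lemma = solve-∀

dot-·ʳ : ∀ c (x y : Zn n) → dot x (c · y) ≡ c * dot x y
dot-·ʳ c x y = trans (dot-comm x (c · y)) (trans (dot-·ˡ c y x) (cong (c *_) (dot-comm y x)))

dot-negˡ : (x y : Zn n) → dot (neg x) y ≡ - dot x y
dot-negˡ []      []      = refl
dot-negˡ (a ∷ x) (b ∷ y) = trans (cong (_+_ (- a * b)) (dot-negˡ x y)) (lemma a b (dot x y))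
  where
  lemma : ∀ a b u → - a * b + - u ≡ - (a * b + u)
  lemma = solve-∀

dot-⊖ˡ : (x y z : Zn n) → dot (x ⊖ y) z ≡ dot x z - dot y z
dot-⊖ˡ x y z = trans (dot-⊕ˡ x (neg y) z) (cong (_+_ (dot x z)) (dot-negˡ y z))

dot-0ʳ : (x : Zn n) → dot x 0v ≡ + 0
dot-0ʳ []      = refl
dot-0ʳ (a ∷ x) = trans (cong₂ _+_ (ℤ.*-zeroʳ a) (dot-0ʳ x)) refl

dot-0ˡ : (x : Zn n) → dot 0v x ≡ + 0
dot-0ˡ x = trans (dot-comm 0v x) (dot-0ʳ x)

dot-norm-⊕ : (u v : Zn n) → dot (u ⊕ v) (u ⊕ v) ≡ dot u u + + 2 * dot u v + dot v v
dot-norm-⊕ u v = begin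
  dot (u ⊕ v) (u ⊕ v)                          ≡⟨ dot-⊕ˡ u v (u ⊕ v) ⟩
  dot u (u ⊕ v) + dot v (u ⊕ v)                ≡⟨ cong₂ _+_ (dot-⊕ʳ u u v) (dot-⊕ʳ v u v) ⟩
  (dot u u + dot u v) + (dot v u + dot v v)    ≡⟨ cong (λ z → (dot u u + dot u v) + (z + dot v v)) (dot-comm v u) ⟩
  (dot u u + dot u v) + (dot u v + dot v v)    ≡⟨ lemma (dot u u) (dot u v) (dot v v) ⟩
  dot u u + + 2 * dot u v + dot v v            ∎
  where
  open ≡-Reasoning
  lemma : ∀ a b c → (a + b) + (b + c) ≡ a + + 2 * b + c
  lemma = solve-∀

dot-unitʳ : (x : Zn n) (i : Fin n) → dot x (unit i) ≡ lookup x i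
dot-unitʳ (a ∷ x) zero    = trans (cong₂ _+_ (ℤ.*-identityʳ a) (dot-0ʳ x)) (ℤ.+-identityʳ a)
dot-unitʳ (a ∷ x) (suc i) = trans (cong₂ _+_ (ℤ.*-zeroʳ a) (dot-unitʳ x i)) (ℤ.+-identityˡ _)

lookup-0v : (j : Fin n) → lookup (0v {n}) j ≡ + 0
lookup-0v zero    = refl
lookup-0v (suc j) = lookup-0v j

lookup-1v : (j : Fin n) → lookup (1v {n}) j ≡ + 1
lookup-1v zero    = refl
lookup-1v (suc j) = lookup-1v j

lookup-unit : (i : Fin n) → lookup (unit i) i ≡ + 1
lookup-unit zero    = refl
lookup-unit (suc i) = lookup-unit i

lookup-unit-≢ : (i j : Fin n) → i ≢ j → lookup (unit i) j ≡ + 0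
lookup-unit-≢ zero    zero    i≢j = ⊥-elim (i≢j refl)
lookup-unit-≢ zero    (suc j) _   = lookup-0v j
lookup-unit-≢ (suc i) zero    _   = refl
lookup-unit-≢ (suc i) (suc j) i≢j = lookup-unit-≢ i j (λ i≡j → i≢j (cong suc i≡j))

private
  idempotent⇒0 : ∀ x → x ≡ x + x → x ≡ + 0
  idempotent⇒0 x x≡2x = begin
    x               ≡⟨ lemma x ⟩
    (x + x) + - x   ≡⟨ cong (_+ - x) (sym x≡2x) ⟩
    x + - x         ≡⟨ ℤ.+-inverseʳ x ⟩
    + 0             ∎
    where
    open ≡-Reasoning
    lemma : ∀ x → x ≡ (x + x) + - x
    lemma = solve-∀

additive-ℤ-linear : (h : ℤ → ℤ) → (∀ a b → h (a + b) ≡ h a + h b) → ∀ a → h a ≡ a * h (+ 1)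
additive-ℤ-linear h h-add = linear
  where
  h0 : h (+ 0) ≡ + 0
  h0 = idempotent⇒0 (h (+ 0)) (h-add (+ 0) (+ 0))
  linear-pos : ∀ k → h (+ k) ≡ + k * h (+ 1)
  linear-pos zero    = trans h0 (sym (ℤ.*-zeroˡ (h (+ 1))))
  linear-pos (suc k) = begin
    h (+ 1 + + k)           ≡⟨ h-add (+ 1) (+ k) ⟩
    h (+ 1) + h (+ k)       ≡⟨ cong (_+_ (h (+ 1))) (linear-pos k) ⟩
    h (+ 1) + + k * h (+ 1) ≡⟨ sym (ℤ.suc-* (+ k) (h (+ 1))) ⟩
    + suc k * h (+ 1)       ∎
    where open ≡-Reasoning
  linear : ∀ a → h a ≡ a * h (+ 1)
  linear (+ k)      = linear-pos k
  linear -[1+ k ] = begin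
    h -[1+ k ]                                  ≡⟨ lemma (h -[1+ k ]) (h (+ suc k)) ⟩
    (h -[1+ k ] + h (+ suc k)) + - h (+ suc k)  ≡⟨ cong (_+ - h (+ suc k)) (sym (h-add -[1+ k ] (+ suc k))) ⟩
    h (-[1+ k ] + + suc k) + - h (+ suc k)      ≡⟨ cong₂ (λ u v → h u + - v) (ℤ.+-inverseˡ (+ suc k)) (linear-pos (suc k)) ⟩
    h (+ 0) + - (+ suc k * h (+ 1))             ≡⟨ cong₂ _+_ h0 (ℤ.neg-distribˡ-* (+ suc k) (h (+ 1))) ⟩
    + 0 + -[1+ k ] * h (+ 1)                    ≡⟨ ℤ.+-identityˡ _ ⟩
    -[1+ k ] * h (+ 1)                          ∎
    where
    open ≡-Reasoning
    lemma : ∀ u v → u ≡ (u + v) + - v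
    lemma = solve-∀

additive-functional : (φ : Zn n → ℤ) → (∀ x y → φ (x ⊕ y) ≡ φ x + φ y) →
                      ∀ v → φ v ≡ dot v (tabulate (λ i → φ (unit i)))
additive-functional {zero}  φ φ-add [] = idempotent⇒0 (φ []) (φ-add [] [])
additive-functional {suc n} φ φ-add (a ∷ v) = begin
  φ (a ∷ v)                           ≡⟨ cong φ (sym split) ⟩
  φ ((a ∷ 0v) ⊕ (+ 0 ∷ v))            ≡⟨ φ-add (a ∷ 0v) (+ 0 ∷ v) ⟩
  φ (a ∷ 0v) + φ (+ 0 ∷ v)            ≡⟨ cong₂ _+_ first rest ⟩
  a * φ (unit zero) + dot v (tabulate (λ i → φ (unit (suc i)))) ∎
  where
  open ≡-Reasoning
  split : (a ∷ 0v) ⊕ (+ 0 ∷ v) ≡ a ∷ v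
  split = cong₂ _∷_ (ℤ.+-identityʳ a) (⊕-identityˡ v)
  first : φ (a ∷ 0v) ≡ a * φ (unit zero)
  first = additive-ℤ-linear (λ c → φ (c ∷ 0v))
            (λ b c → trans (cong (λ z → φ ((b + c) ∷ z)) (sym (⊕-identityˡ 0v))) (φ-add (b ∷ 0v) (c ∷ 0v))) a
  rest : φ (+ 0 ∷ v) ≡ dot v (tabulate (λ i → φ (unit (suc i))))
  rest = additive-functional (λ u → φ (+ 0 ∷ u)) (λ x y → φ-add (+ 0 ∷ x) (+ 0 ∷ y)) v

module _ {F : Zn n → Zn m} (F-additive : Additive F) where

  private
    column : Fin m → Zn n
    column j = tabulate (λ i → lookup (F (unit i)) j)

  lookup-additive : ∀ v j → lookup (F v) j ≡ dot v (column j)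
  lookup-additive v j =
    additive-functional (λ u → lookup (F u) j)
      (λ x y → trans (cong (λ z → lookup z j) (F-additive x y)) (lookup-⊕ (F x) (F y) j)) v

  additive-· : ∀ c v → F (c · v) ≡ c · F v
  additive-· c v = lookup-ext λ j → begin
    lookup (F (c · v)) j     ≡⟨ lookup-additive (c · v) j ⟩
    dot (c · v) (column j)   ≡⟨ dot-·ˡ c v (column j) ⟩
    c * dot v (column j)     ≡⟨ cong (c *_) (sym (lookup-additive v j)) ⟩
    c * lookup (F v) j       ≡⟨ sym (lookup-map j (c *_) (F v)) ⟩
    lookup (c · F v) j       ∎
    where open ≡-Reasoning

  additive-neg : ∀ v → F (neg v) ≡ neg (F v)
  additive-neg v = lookup-ext λ j → begin
    lookup (F (neg v)) j     ≡⟨ lookup-additive (neg v) j ⟩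
    dot (neg v) (column j)   ≡⟨ dot-negˡ v (column j) ⟩
    - dot v (column j)       ≡⟨ cong -_ (sym (lookup-additive v j)) ⟩
    - lookup (F v) j         ≡⟨ sym (lookup-map j -_ (F v)) ⟩
    lookup (neg (F v)) j     ∎
    where open ≡-Reasoning

  additive-⊖ : ∀ x y → F (x ⊖ y) ≡ F x ⊖ F y
  additive-⊖ x y = trans (F-additive x (neg y)) (cong (_⊕_ (F x)) (additive-neg y))

  additive-0 : F 0v ≡ 0v
  additive-0 = lookup-ext λ j → begin
    lookup (F 0v) j   ≡⟨ lookup-additive 0v j ⟩
    dot 0v (column j) ≡⟨ dot-0ˡ (column j) ⟩
    + 0               ≡⟨ sym (lookup-0v j) ⟩
    lookup (0v {m}) j ∎
    where open ≡-Reasoning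

  transposeMap : Zn m → Zn n
  transposeMap c = tabulate (λ j → dot c (F (unit j)))

  dot-transposeMap : ∀ c w → dot c (F w) ≡ dot (transposeMap c) w
  dot-transposeMap c w =
    trans (additive-functional (λ u → dot c (F u)) (λ x y → trans (cong (dot c) (F-additive x y)) (dot-⊕ʳ c (F x) (F y))) w)
          (dot-comm w (transposeMap c))

additive-unique : {F G : Zn n → Zn m} → Additive F → Additive G → (∀ i → F (unit i) ≡ G (unit i)) → ∀ v → F v ≡ G v
additive-unique {F = F} {G} F-additive G-additive F≡G v = lookup-ext λ j → begin
  lookup (F v) j                                    ≡⟨ lookup-additive F-additive v j ⟩
  dot v (tabulate (λ i → lookup (F (unit i)) j))    ≡⟨ cong (dot v) (tabulate-cong λ i → cong (λ z → lookup z j) (F≡G i)) ⟩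
  dot v (tabulate (λ i → lookup (G (unit i)) j))    ≡⟨ sym (lookup-additive G-additive v j) ⟩
  lookup (G v) j                                    ∎
  where open ≡-Reasoning

combination : (Fin n → Zn m) → Zn n → Zn m
combination t v = tabulate (λ j → dot v (tabulate (λ i → lookup (t i) j)))

combination-additive : (t : Fin n → Zn m) → Additive (combination t)
combination-additive t x y = lookup-ext λ j → begin
  lookup (combination t (x ⊕ y)) j                           ≡⟨ lookup∘tabulate _ j ⟩
  dot (x ⊕ y) _                                             ≡⟨ dot-⊕ˡ x y _ ⟩
  dot x _ + dot y _                                         ≡⟨ sym (cong₂ _+_ (lookup∘tabulate _ j) (lookup∘tabulate _ j)) ⟩
  lookup (combination t x) j + lookup (combination t y) j   ≡⟨ sym (lookup-⊕ (combination t x) (combination t y) j) ⟩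
  lookup (combination t x ⊕ combination t y) j              ∎
  where open ≡-Reasoning

combination-unit : (t : Fin n → Zn m) (i : Fin n) → combination t (unit i) ≡ t i
combination-unit {n} {m} t i = lookup-ext λ j →
  trans (lookup∘tabulate _ j) (trans (dot-comm (unit i) (column j)) (trans (dot-unitʳ (column j) i) (lookup∘tabulate _ i)))
  where
  column : Fin m → Zn n
  column j = tabulate (λ i → lookup (t i) j)

-- Gram matrices

mulVec : Vec (Zn m) k → Zn m → Zn k
mulVec G y = map (λ row → dot row y) G

vecMul : Zn k → Vec (Zn m) k → Zn m
vecMul []      []      = 0v
vecMul (a ∷ x) (r ∷ G) = (a · r) ⊕ vecMul x G

dot-mulVec : (x : Zn k) (G : Vec (Zn m) k) (y : Zn m) → dot x (mulVec G y) ≡ dot (vecMul x G) y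
dot-mulVec []      []      y = sym (dot-0ˡ y)
dot-mulVec (a ∷ x) (r ∷ G) y = begin
  a * dot r y + dot x (mulVec G y)       ≡⟨ cong₂ _+_ (sym (dot-·ˡ a r y)) (dot-mulVec x G y) ⟩
  dot (a · r) y + dot (vecMul x G) y     ≡⟨ sym (dot-⊕ˡ (a · r) (vecMul x G) y) ⟩
  dot ((a · r) ⊕ vecMul x G) y           ∎
  where open ≡-Reasoning

lookup-vecMul : (x : Zn k) (G : Vec (Zn m) k) (j : Fin m) → lookup (vecMul x G) j ≡ dot x (map (λ r → lookup r j) G)
lookup-vecMul []      []      j = lookup-0v j
lookup-vecMul (a ∷ x) (r ∷ G) j =
  trans (lookup-⊕ (a · r) (vecMul x G) j) (cong₂ _+_ (lookup-map j (a *_) r) (lookup-vecMul x G j))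

BG-sym : (G : Gram m) → (∀ i j → lookup (lookup G i) j ≡ lookup (lookup G j) i) →
         ∀ x y → BG G x y ≡ BG G y x
BG-sym G G-sym x y = begin
  dot x (mulVec G y)   ≡⟨ dot-mulVec x G y ⟩
  dot (vecMul x G) y   ≡⟨ cong (λ z → dot z y) vecMul≡mulVec ⟩
  dot (mulVec G x) y   ≡⟨ dot-comm (mulVec G x) y ⟩
  dot y (mulVec G x)   ∎
  where
  open ≡-Reasoning
  column≡row : ∀ j → map (λ r → lookup r j) G ≡ lookup G j
  column≡row j = lookup-ext λ i → trans (lookup-map i (λ r → lookup r j) G) (G-sym i j)
  vecMul≡mulVec : vecMul x G ≡ mulVec G x
  vecMul≡mulVec = lookup-ext λ j → begin
    lookup (vecMul x G) j   ≡⟨ lookup-vecMul x G j ⟩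
    dot x _                 ≡⟨ cong (dot x) (column≡row j) ⟩
    dot x (lookup G j)      ≡⟨ dot-comm x (lookup G j) ⟩
    dot (lookup G j) x      ≡⟨ sym (lookup-map j (λ row → dot row x) G) ⟩
    lookup (mulVec G x) j   ∎

module _ (L : IntLattice m) where

  B-sym : ∀ x y → B L x y ≡ B L y x
  B-sym = BG-sym (gram L) (symmetric L)

  B-⊕ˡ : ∀ x y z → B L (x ⊕ y) z ≡ B L x z + B L y z
  B-⊕ˡ x y z = dot-⊕ˡ x y _

  B-·ˡ : ∀ c x y → B L (c · x) y ≡ c * B L x y
  B-·ˡ c x y = dot-·ˡ c x _

  B-⊕ʳ : ∀ x y z → B L x (y ⊕ z) ≡ B L x y + B L x z
  B-⊕ʳ x y z = trans (B-sym x (y ⊕ z)) (trans (B-⊕ˡ y z x) (cong₂ _+_ (B-sym y x) (B-sym z x)))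

  B-·ʳ : ∀ c x y → B L x (c · y) ≡ c * B L x y
  B-·ʳ c x y = trans (B-sym x (c · y)) (trans (B-·ˡ c y x) (cong (c *_) (B-sym y x)))

  B-norm-⊕ : (x y : Zn m) → B L (x ⊕ y) (x ⊕ y) ≡ B L x x + + 2 * B L x y + B L y y
  B-norm-⊕ x y = begin
    B L (x ⊕ y) (x ⊕ y)                          ≡⟨ B-⊕ˡ x y (x ⊕ y) ⟩
    B L x (x ⊕ y) + B L y (x ⊕ y)                ≡⟨ cong₂ _+_ (B-⊕ʳ x x y) (B-⊕ʳ y x y) ⟩
    (B L x x + B L x y) + (B L y x + B L y y)    ≡⟨ cong (λ z → (B L x x + B L x y) + (z + B L y y)) (B-sym y x) ⟩
    (B L x x + B L x y) + (B L x y + B L y y)    ≡⟨ lemma (B L x x) (B L x y) (B L y y) ⟩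
    B L x x + + 2 * B L x y + B L y y            ∎
    where
    open ≡-Reasoning
    lemma : ∀ a b c → (a + b) + (b + c) ≡ a + + 2 * b + c
    lemma = solve-∀

  module _ {β : Zn k → Zn m} (β-additive : Additive β) where

    pullback : Gram k
    pullback = tabulate (λ i → tabulate (λ j → B L (β (unit i)) (β (unit j))))

    BG-pullback : ∀ w w′ → BG pullback w w′ ≡ B L (β w) (β w′)
    BG-pullback w w′ = begin
      dot w (map (λ row → dot row w′) pullback)
        ≡⟨ cong (dot w) (sym (tabulate-∘ (λ row → dot row w′) (λ i → tabulate (λ j → B L (β (unit i)) (β (unit j)))))) ⟩
      dot w (tabulate (λ i → dot (tabulate (λ j → B L (β (unit i)) (β (unit j)))) w′))
        ≡⟨ cong (dot w) (tabulate-cong λ i → trans (dot-comm _ w′) (sym (right i w′))) ⟩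
      dot w (tabulate (λ i → B L (β (unit i)) (β w′)))
        ≡⟨ sym (left w) ⟩
      B L (β w) (β w′) ∎
      where
      open ≡-Reasoning
      right : ∀ i w′ → B L (β (unit i)) (β w′) ≡ dot w′ (tabulate (λ j → B L (β (unit i)) (β (unit j))))
      right i = additive-functional (λ u → B L (β (unit i)) (β u))
                  (λ x y → trans (cong (B L (β (unit i))) (β-additive x y)) (B-⊕ʳ (β (unit i)) (β x) (β y)))
      left : ∀ w → B L (β w) (β w′) ≡ dot w (tabulate (λ i → B L (β (unit i)) (β w′)))
      left = additive-functional (λ u → B L (β u) (β w′))
               (λ x y → trans (cong (λ z → B L z (β w′)) (β-additive x y)) (B-⊕ˡ (β x) (β y) (β w′)))

    pullbackLattice : (∀ w → β w ≡ 0v → w ≡ 0v) → IntLattice k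
    pullbackLattice β-injective = record
      { gram      = pullback
      ; symmetric = λ i j → trans (entry i j) (trans (B-sym (β (unit i)) (β (unit j))) (sym (entry j i)))
      ; posdef    = λ w w≢0 → subst (+ 0 <_) (sym (BG-pullback w w)) (posdef L (β w) (λ βw≡0 → w≢0 (β-injective w βw≡0)))
      }
      where
      entry : ∀ i j → lookup (lookup pullback i) j ≡ B L (β (unit i)) (β (unit j))
      entry i j = trans (cong (λ r → lookup r j) (lookup∘tabulate _ i)) (lookup∘tabulate _ j)

-- Bases of common kernels

record SubgroupBasis (m k : ℕ) (Z : Zn m → Set) : Set where
  field
    embed           : Zn k → Zn m
    coords          : Zn m → Zn k
    embed-additive  : Additive embed
    coords-additive : Additive coords
    embed-∈         : ∀ w → Z (embed w)
    coords-embed    : ∀ w → coords (embed w) ≡ w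
    embed-coords    : ∀ x → Z x → embed (coords x) ≡ x

SubgroupBasis-⇔ : {Z Z′ : Zn m → Set} → (∀ x → Z x → Z′ x) → (∀ x → Z′ x → Z x) →
                  SubgroupBasis m k Z → SubgroupBasis m k Z′
SubgroupBasis-⇔ to from 𝔅 = record
  { embed = embed ; coords = coords ; embed-additive = embed-additive ; coords-additive = coords-additive
  ; embed-∈ = λ w → to _ (embed-∈ w) ; coords-embed = coords-embed
  ; embed-coords = λ x x∈ → embed-coords x (from x x∈) }
  where open SubgroupBasis 𝔅

SubgroupBasis-∘ : {Z₁ Z₂ : Zn m → Set} (𝔅 : SubgroupBasis m k Z₁) →
                  SubgroupBasis k l (λ w → Z₂ (SubgroupBasis.embed 𝔅 w)) →
                  SubgroupBasis m l (λ x → Z₁ x × Z₂ x)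
SubgroupBasis-∘ {Z₂ = Z₂} 𝔅 ℭ = record
  { embed           = λ w → B.embed (C.embed w)
  ; coords          = λ x → C.coords (B.coords x)
  ; embed-additive  = λ x y → trans (cong B.embed (C.embed-additive x y)) (B.embed-additive _ _)
  ; coords-additive = λ x y → trans (cong C.coords (B.coords-additive x y)) (C.coords-additive _ _)
  ; embed-∈         = λ w → B.embed-∈ (C.embed w) , C.embed-∈ w
  ; coords-embed    = λ w → trans (cong C.coords (B.coords-embed (C.embed w))) (C.coords-embed w)
  ; embed-coords    = λ x (x∈₁ , x∈₂) →
      let embed-coords-x = B.embed-coords x x∈₁ in
      trans (cong B.embed (C.embed-coords (B.coords x) (subst Z₂ (sym embed-coords-x) x∈₂))) embed-coords-x
  }
  where
  module B = SubgroupBasis 𝔅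
  module C = SubgroupBasis ℭ

record Reduction (a b : ℤ) : Set where
  constructor reduction
  field
    p q r s     : ℤ
    det         : p * s - q * r ≡ + 1
    annihilates : a * p + b * r ≡ + 0

reduction-step : ∀ a b .{{_ : ℤ.NonZero b}} → Reduction b (+ (a % b)) → Reduction a b
reduction-step a b (reduction p q r s det annihilates) =
  reduction (- r) s (Q * r - p) (q - Q * s) (trans (det-lemma p q r s Q) det) annihilates′
  where
  Q : ℤ
  Q = a / b
  det-lemma : ∀ p q r s Q → - r * (q - Q * s) - s * (Q * r - p) ≡ p * s - q * r
  det-lemma = solve-∀
  lemma : ∀ R Q b p r → (R + Q * b) * - r + b * (Q * r - p) ≡ - (b * p + R * r)
  lemma = solve-∀
  annihilates′ : a * - r + b * (Q * r - p) ≡ + 0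
  annihilates′ = begin
    a * - r + b * (Q * r - p)                         ≡⟨ cong (λ a → a * - r + b * (Q * r - p)) (a≡a%n+[a/n]*n a b) ⟩
    (+ (a % b) + Q * b) * - r + b * (Q * r - p)       ≡⟨ lemma (+ (a % b)) Q b p r ⟩
    - (b * p + + (a % b) * r)                         ≡⟨ cong -_ annihilates ⟩
    + 0                                               ∎
    where open ≡-Reasoning

reduction-bounded : ∀ f a b → ∣ b ∣ ℕ.< f → Reduction a b
reduction-bounded f       a (+ 0)        _  = reduction (+ 0) (+ 1) (- + 1) (+ 0) refl (trans (ℤ.+-identityʳ (a * + 0)) (ℤ.*-zeroʳ a))
reduction-bounded (suc f) a b@(+[1+ _ ]) lt =
  reduction-step a b (reduction-bounded f b (+ (a % b)) (ℕ.<-≤-trans (n%d<d a b) (ℕ.≤-pred lt)))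
reduction-bounded (suc f) a b@(-[1+ _ ]) lt =
  reduction-step a b (reduction-bounded f b (+ (a % b)) (ℕ.<-≤-trans (n%d<d a b) (ℕ.≤-pred lt)))

reduce : ∀ a b → Reduction a b
reduce a b = reduction-bounded (suc ∣ b ∣) a b (ℕ.n<1+n ∣ b ∣)

module Reduction-Action {a b} (R : Reduction a b) where
  open Reduction R

  act : Zn (suc (suc k)) → Zn (suc (suc k))
  act (y₀ ∷ y₁ ∷ y) = (p * y₀ + q * y₁) ∷ (r * y₀ + s * y₁) ∷ y

  act⁻¹ : Zn (suc (suc k)) → Zn (suc (suc k))
  act⁻¹ (x₀ ∷ x₁ ∷ x) = (s * x₀ - q * x₁) ∷ (p * x₁ - r * x₀) ∷ x

  act-additive : Additive (act {k})
  act-additive (x₀ ∷ x₁ ∷ x) (y₀ ∷ y₁ ∷ y) =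
    cong₂ _∷_ (lemma p q x₀ x₁ y₀ y₁) (cong₂ _∷_ (lemma r s x₀ x₁ y₀ y₁) refl)
    where
    lemma : ∀ p q x₀ x₁ y₀ y₁ → p * (x₀ + y₀) + q * (x₁ + y₁) ≡ (p * x₀ + q * x₁) + (p * y₀ + q * y₁)
    lemma = solve-∀

  act⁻¹-additive : Additive (act⁻¹ {k})
  act⁻¹-additive (x₀ ∷ x₁ ∷ x) (y₀ ∷ y₁ ∷ y) =
    cong₂ _∷_ (lemma s q x₀ x₁ y₀ y₁) (cong₂ _∷_ (lemma p r x₁ x₀ y₁ y₀) refl)
    where
    lemma : ∀ s q x₀ x₁ y₀ y₁ → s * (x₀ + y₀) - q * (x₁ + y₁) ≡ (s * x₀ - q * x₁) + (s * y₀ - q * y₁)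
    lemma = solve-∀

  act-act⁻¹ : (x : Zn (suc (suc k))) → act (act⁻¹ x) ≡ x
  act-act⁻¹ (x₀ ∷ x₁ ∷ x) =
    cong₂ _∷_ (trans (lemma₀ p q r s x₀ x₁) (by-det x₀)) (cong₂ _∷_ (trans (lemma₁ p q r s x₀ x₁) (by-det x₁)) refl)
    where
    by-det : ∀ z → (p * s - q * r) * z ≡ z
    by-det z = trans (cong (_* z) det) (ℤ.*-identityˡ z)
    lemma₀ : ∀ p q r s x₀ x₁ → p * (s * x₀ - q * x₁) + q * (p * x₁ - r * x₀) ≡ (p * s - q * r) * x₀
    lemma₀ = solve-∀
    lemma₁ : ∀ p q r s x₀ x₁ → r * (s * x₀ - q * x₁) + s * (p * x₁ - r * x₀) ≡ (p * s - q * r) * x₁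
    lemma₁ = solve-∀

  act⁻¹-act : (y : Zn (suc (suc k))) → act⁻¹ (act y) ≡ y
  act⁻¹-act (y₀ ∷ y₁ ∷ y) =
    cong₂ _∷_ (trans (lemma₀ p q r s y₀ y₁) (by-det y₀)) (cong₂ _∷_ (trans (lemma₁ p q r s y₀ y₁) (by-det y₁)) refl)
    where
    by-det : ∀ z → (p * s - q * r) * z ≡ z
    by-det z = trans (cong (_* z) det) (ℤ.*-identityˡ z)
    lemma₀ : ∀ p q r s y₀ y₁ → s * (p * y₀ + q * y₁) - q * (r * y₀ + s * y₁) ≡ (p * s - q * r) * y₀
    lemma₀ = solve-∀
    lemma₁ : ∀ p q r s y₀ y₁ → p * (r * y₀ + s * y₁) - r * (p * y₀ + q * y₁) ≡ (p * s - q * r) * y₁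
    lemma₁ = solve-∀

  dot-act : (c : Zn k) (y₀ : ℤ) (z : Zn (suc k)) → dot (a ∷ b ∷ c) (act (y₀ ∷ z)) ≡ dot ((a * q + b * s) ∷ c) z
  dot-act c y₀ (y₁ ∷ y) = begin
    a * (p * y₀ + q * y₁) + (b * (r * y₀ + s * y₁) + dot c y) ≡⟨ lemma a b p q r s y₀ y₁ (dot c y) ⟩
    (a * p + b * r) * y₀ + ((a * q + b * s) * y₁ + dot c y)   ≡⟨ cong (λ z → z * y₀ + ((a * q + b * s) * y₁ + dot c y)) annihilates ⟩
    + 0 * y₀ + ((a * q + b * s) * y₁ + dot c y)               ≡⟨ ℤ.+-identityˡ _ ⟩
    (a * q + b * s) * y₁ + dot c y                            ∎
    where
    open ≡-Reasoning
    lemma : ∀ a b p q r s y₀ y₁ u → a * (p * y₀ + q * y₁) + (b * (r * y₀ + s * y₁) + u)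
                                  ≡ (a * p + b * r) * y₀ + ((a * q + b * s) * y₁ + u)
    lemma = solve-∀

Annihilator : Zn m → Zn m → Set
Annihilator c x = dot c x ≡ + 0

-- A unimodular change of the first two coordinates turns c into (0, g, c₂, …).
kernelBasis₁ : ∀ k (c u : Zn (suc k)) → dot c u ≢ + 0 → SubgroupBasis (suc k) k (Annihilator c)
kernelBasis₁ zero (c₀ ∷ []) (u₀ ∷ []) cu≢0 = record
  { embed = λ _ → 0v ; coords = λ _ → [] ; embed-additive = λ _ _ → refl ; coords-additive = λ _ _ → refl
  ; embed-∈ = λ _ → dot-0ʳ (c₀ ∷ []) ; coords-embed = λ { [] → refl }
  ; embed-coords = λ { (x₀ ∷ []) cx≡0 → cong (_∷ []) (sym (x₀≡0 x₀ cx≡0)) } }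
  where
  x₀≡0 : ∀ x₀ → c₀ * x₀ + + 0 ≡ + 0 → x₀ ≡ + 0
  x₀≡0 x₀ eq with ℤ.i*j≡0⇒i≡0∨j≡0 c₀ (trans (sym (ℤ.+-identityʳ _)) eq)
  ... | inj₁ c₀≡0 = ⊥-elim (cu≢0 (cong (λ c → c * u₀ + + 0) c₀≡0))
  ... | inj₂ x₀≡0 = x₀≡0
kernelBasis₁ (suc k) (c₀ ∷ c₁ ∷ c) u cu≢0 = record
  { embed = embed ; coords = coords ; embed-additive = embed-additive ; coords-additive = coords-additive
  ; embed-∈ = embed-∈ ; coords-embed = coords-embed ; embed-coords = embed-coords }
  where
  R : Reduction c₀ c₁
  R = reduce c₀ c₁
  open Reduction-Action R
  c′ : Zn (suc k)
  c′ = (c₀ * Reduction.q R + c₁ * Reduction.s R) ∷ c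
  dot-c′ : ∀ x → dot (c₀ ∷ c₁ ∷ c) x ≡ dot c′ (tail (act⁻¹ x))
  dot-c′ x = trans (cong (dot (c₀ ∷ c₁ ∷ c)) (sym (act-act⁻¹ x))) (shape (act⁻¹ x))
    where
    shape : (y : Zn (suc (suc k))) → dot (c₀ ∷ c₁ ∷ c) (act y) ≡ dot c′ (tail y)
    shape (y₀ ∷ z) = dot-act c y₀ z
  module K = SubgroupBasis (kernelBasis₁ k c′ (tail (act⁻¹ u)) (λ eq → cu≢0 (trans (dot-c′ u) eq)))
  embed : Zn (suc k) → Zn (suc (suc k))
  embed (t ∷ w) = act (t ∷ K.embed w)
  coords : Zn (suc (suc k)) → Zn (suc k)
  coords x = head (act⁻¹ x) ∷ K.coords (tail (act⁻¹ x))
  embed-additive : Additive embed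
  embed-additive (t ∷ w) (t′ ∷ w′) = trans (cong (λ z → act (t + t′ ∷ z)) (K.embed-additive w w′)) (act-additive _ _)
  coords-additive : Additive coords
  coords-additive x y with act⁻¹ x | act⁻¹ y | act⁻¹-additive x y
  ... | x₀ ∷ x′ | y₀ ∷ y′ | eq =
    cong₂ _∷_ (cong head eq) (trans (cong (λ z → K.coords (tail z)) eq) (K.coords-additive x′ y′))
  embed-∈ : ∀ w → Annihilator (c₀ ∷ c₁ ∷ c) (embed w)
  embed-∈ (t ∷ w) = trans (dot-act c t (K.embed w)) (K.embed-∈ w)
  coords-embed : ∀ w → coords (embed w) ≡ w
  coords-embed (t ∷ w) rewrite act⁻¹-act (t ∷ K.embed w) = cong (t ∷_) (K.coords-embed w)
  embed-coords : ∀ x → Annihilator (c₀ ∷ c₁ ∷ c) x → embed (coords x) ≡ x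
  embed-coords x cx≡0 with act⁻¹ x | act-act⁻¹ x | dot-c′ x
  ... | y₀ ∷ y | act-y≡x | cx≡c′y =
    trans (cong (λ z → act (y₀ ∷ z)) (K.embed-coords y (trans (sym cx≡c′y) cx≡0))) act-y≡x

kernelBasis : ∀ n m (cs us : Fin n → Zn m) → (∀ i → dot (cs i) (us i) ≢ + 0) →
              (∀ i j → i ≢ j → dot (cs i) (us j) ≡ + 0) →
              Σ ℕ λ k → SubgroupBasis m k (λ x → ∀ i → Annihilator (cs i) x)
kernelBasis zero m cs us _ _ = m , record
  { embed = λ w → w ; coords = λ x → x ; embed-additive = λ _ _ → refl ; coords-additive = λ _ _ → refl
  ; embed-∈ = λ _ () ; coords-embed = λ _ → refl ; embed-coords = λ _ _ → refl }
kernelBasis (suc n) zero cs us diag _ = ⊥-elim (diag zero (dot-Zn0 (cs zero) (us zero)))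
  where
  dot-Zn0 : (x y : Zn 0) → dot x y ≡ + 0
  dot-Zn0 [] [] = refl
kernelBasis (suc n) (suc m) cs us diag off =
  proj₁ rest , SubgroupBasis-⇔ combine split (SubgroupBasis-∘ K restBasis)
  where
  K : SubgroupBasis (suc m) m (Annihilator (cs zero))
  K = kernelBasis₁ m (cs zero) (us zero) (diag zero)
  open SubgroupBasis K
  cs′ : Fin n → Zn m
  cs′ i = transposeMap embed-additive (cs (suc i))
  us′ : Fin n → Zn m
  us′ i = coords (us (suc i))
  dot-cs′-us′ : ∀ i j → dot (cs′ i) (us′ j) ≡ dot (cs (suc i)) (us (suc j))
  dot-cs′-us′ i j = trans (sym (dot-transposeMap embed-additive (cs (suc i)) (us′ j)))
                          (cong (dot (cs (suc i))) (embed-coords (us (suc j)) (off zero (suc j) λ ())))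
  rest : Σ ℕ λ k → SubgroupBasis m k (λ w → ∀ i → Annihilator (cs′ i) w)
  rest = kernelBasis n m cs′ us′ (λ i eq → diag (suc i) (trans (sym (dot-cs′-us′ i i)) eq))
                                (λ i j i≢j → trans (dot-cs′-us′ i j) (off (suc i) (suc j) λ eq → i≢j (suc-injective eq)))
  restBasis : SubgroupBasis m (proj₁ rest) (λ w → ∀ i → Annihilator (cs (suc i)) (embed w))
  restBasis = SubgroupBasis-⇔ (λ w h i → trans (dot-transposeMap embed-additive (cs (suc i)) w) (h i))
                              (λ w h i → trans (sym (dot-transposeMap embed-additive (cs (suc i)) w)) (h i))
                              (proj₂ rest)
  combine : ∀ x → Annihilator (cs zero) x × (∀ i → Annihilator (cs (suc i)) x) → ∀ i → Annihilator (cs i) x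
  combine x (h₀ , hₛ) zero    = h₀
  combine x (h₀ , hₛ) (suc i) = hₛ i
  split : ∀ x → (∀ i → Annihilator (cs i) x) → Annihilator (cs zero) x × (∀ i → Annihilator (cs (suc i)) x)
  split x h = h zero , λ i → h (suc i)

-- Splitting off a unimodular sublattice

module _ (L : IntLattice m) (t : Fin n → Zn m) where

  pairings : Zn m → Zn n
  pairings x = tabulate (λ i → B L x (t i))

  pairings-additive : Additive pairings
  pairings-additive x y = lookup-ext λ i → begin
    lookup (pairings (x ⊕ y)) i                     ≡⟨ lookup∘tabulate _ i ⟩
    B L (x ⊕ y) (t i)                               ≡⟨ B-⊕ˡ L x y (t i) ⟩
    B L x (t i) + B L y (t i)                       ≡⟨ sym (cong₂ _+_ (lookup∘tabulate _ i) (lookup∘tabulate _ i)) ⟩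
    lookup (pairings x) i + lookup (pairings y) i   ≡⟨ sym (lookup-⊕ (pairings x) (pairings y) i) ⟩
    lookup (pairings x ⊕ pairings y) i              ∎
    where open ≡-Reasoning

  record ScaledSection (P : Zn n → Set) (s : ℤ) (ψ : Zn n → Zn m) : Set where
    field
      pairings-∈ : ∀ x → P (pairings x)
      ψ-additive : ∀ v v′ → P v → P v′ → P (v ⊕ v′) → ψ (v ⊕ v′) ≡ ψ v ⊕ ψ v′
      pairings-ψ : ∀ v → P v → pairings (ψ v) ≡ v
      ψ-adjoint  : ∀ v z → P v → s * B L (ψ v) z ≡ dot v (pairings z)

  splitOff : (∀ i → B L (t i) (t i) ≢ + 0) → (∀ i j → i ≢ j → B L (t i) (t j) ≡ + 0) →
             ∀ {P s ψ} → ScaledSection P s ψ →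
             Σ ℕ λ k → Σ (IntLattice k) λ N → IsometricPerp L n P s N
  splitOff t-nondegenerate t-orthogonal {P} {s} {ψ} section =
    rank , N , f , g , f-additive , pairings-∈ , g-f , f-g , f-isometric
    where
    open ScaledSection section

    rows : Fin n → Zn m
    rows i = mulVec (gram L) (t i)

    dot-rows : ∀ i x → dot (rows i) x ≡ B L x (t i)
    dot-rows i x = dot-comm (rows i) x

    kernel : Σ ℕ λ k → SubgroupBasis m k (λ x → ∀ i → Annihilator (rows i) x)
    kernel = kernelBasis n m rows t
               (λ i eq → t-nondegenerate i (trans (sym (dot-rows i (t i))) eq))
               (λ i j i≢j → trans (dot-rows i (t j)) (t-orthogonal j i (λ eq → i≢j (sym eq))))
    rank : ℕ
    rank = proj₁ kernel
    open SubgroupBasis (proj₂ kernel)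

    N : IntLattice rank
    N = pullbackLattice L embed-additive λ w embed-w≡0 →
          trans (sym (coords-embed w)) (trans (cong coords embed-w≡0) (additive-0 coords-additive))

    pairings≡0⇒∈ : ∀ x → pairings x ≡ 0v → ∀ i → Annihilator (rows i) x
    pairings≡0⇒∈ x eq i = begin
      dot (rows i) x         ≡⟨ dot-rows i x ⟩
      B L x (t i)            ≡⟨ sym (lookup∘tabulate _ i) ⟩
      lookup (pairings x) i  ≡⟨ cong (λ v → lookup v i) eq ⟩
      lookup (0v {n}) i      ≡⟨ lookup-0v i ⟩
      + 0                    ∎
      where open ≡-Reasoning

    pairings-embed : ∀ w → pairings (embed w) ≡ 0v
    pairings-embed w = lookup-ext λ i →
      trans (lookup∘tabulate _ i) (trans (sym (dot-rows i (embed w))) (trans (embed-∈ w i) (sym (lookup-0v i))))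

    π : Zn m → Zn m
    π x = x ⊖ ψ (pairings x)

    pairings-π : ∀ x → pairings (π x) ≡ 0v
    pairings-π x = begin
      pairings (x ⊖ ψ (pairings x))                ≡⟨ additive-⊖ pairings-additive x (ψ (pairings x)) ⟩
      pairings x ⊖ pairings (ψ (pairings x))       ≡⟨ cong (_⊖_ (pairings x)) (pairings-ψ _ (pairings-∈ x)) ⟩
      pairings x ⊖ pairings x                      ≡⟨ ⊖-self (pairings x) ⟩
      0v                                           ∎
      where open ≡-Reasoning

    embed-coords-π : ∀ x → embed (coords (π x)) ≡ π x
    embed-coords-π x = embed-coords (π x) (pairings≡0⇒∈ (π x) (pairings-π x))

    f : Zn m → Zn n × Zn rank
    f x = pairings x , coords (π x)

    g : Zn n → Zn rank → Zn m
    g v w = ψ v ⊕ embed w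

    π-additive : Additive π
    π-additive x y = begin
      (x ⊕ y) ⊖ ψ (pairings (x ⊕ y))                       ≡⟨ cong (λ v → (x ⊕ y) ⊖ ψ v) (pairings-additive x y) ⟩
      (x ⊕ y) ⊖ ψ (pairings x ⊕ pairings y)                ≡⟨ cong (_⊖_ (x ⊕ y)) ψ-split ⟩
      (x ⊕ y) ⊖ (ψ (pairings x) ⊕ ψ (pairings y))          ≡⟨ ⊕-⊖-interchange x y _ _ ⟩
      π x ⊕ π y                                            ∎
      where
      open ≡-Reasoning
      ψ-split : ψ (pairings x ⊕ pairings y) ≡ ψ (pairings x) ⊕ ψ (pairings y)
      ψ-split = ψ-additive _ _ (pairings-∈ x) (pairings-∈ y) (subst P (pairings-additive x y) (pairings-∈ (x ⊕ y)))

    f-additive : ∀ x y → f (x ⊕ y) ≡ (proj₁ (f x) ⊕ proj₁ (f y) , proj₂ (f x) ⊕ proj₂ (f y))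
    f-additive x y = cong₂ _,_ (pairings-additive x y) (trans (cong coords (π-additive x y)) (coords-additive (π x) (π y)))

    g-f : ∀ x → g (proj₁ (f x)) (proj₂ (f x)) ≡ x
    g-f x = trans (cong (_⊕_ (ψ (pairings x))) (embed-coords-π x)) (⊕-⊖-cancelʳ x (ψ (pairings x)))

    f-g : ∀ v w → P v → f (g v w) ≡ (v , w)
    f-g v w v∈ = cong₂ _,_ pairings-g (begin
      coords ((ψ v ⊕ embed w) ⊖ ψ (pairings (ψ v ⊕ embed w)))   ≡⟨ cong (λ u → coords ((ψ v ⊕ embed w) ⊖ ψ u)) pairings-g ⟩
      coords ((ψ v ⊕ embed w) ⊖ ψ v)                           ≡⟨ cong coords (⊕-⊖-cancelˡ (ψ v) (embed w)) ⟩
      coords (embed w)                                         ≡⟨ coords-embed w ⟩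
      w                                                        ∎)
      where
      open ≡-Reasoning
      pairings-g : pairings (ψ v ⊕ embed w) ≡ v
      pairings-g = begin
        pairings (ψ v ⊕ embed w)               ≡⟨ pairings-additive (ψ v) (embed w) ⟩
        pairings (ψ v) ⊕ pairings (embed w)    ≡⟨ cong₂ _⊕_ (pairings-ψ v v∈) (pairings-embed w) ⟩
        v ⊕ 0v                                 ≡⟨ ⊕-identityʳ v ⟩
        v                                      ∎

    ψ-orthogonal-π : ∀ x y → s * B L (π x) (ψ (pairings y)) ≡ + 0
    ψ-orthogonal-π x y = begin
      s * B L (π x) (ψ (pairings y))   ≡⟨ cong (s *_) (B-sym L (π x) _) ⟩
      s * B L (ψ (pairings y)) (π x)   ≡⟨ ψ-adjoint _ (π x) (pairings-∈ y) ⟩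
      dot (pairings y) (pairings (π x)) ≡⟨ cong (dot (pairings y)) (pairings-π x) ⟩
      dot (pairings y) 0v              ≡⟨ dot-0ʳ (pairings y) ⟩
      + 0                              ∎
      where open ≡-Reasoning

    f-isometric : ∀ x y → s * B L x y ≡ dot (proj₁ (f x)) (proj₁ (f y)) + s * B N (proj₂ (f x)) (proj₂ (f y))
    f-isometric x y = begin
      s * B L x y
        ≡⟨ cong (λ z → s * B L z y) (sym (⊕-⊖-cancelʳ x (ψ v))) ⟩
      s * B L (ψ v ⊕ π x) y
        ≡⟨ trans (cong (s *_) (B-⊕ˡ L (ψ v) (π x) y)) (ℤ.*-distribˡ-+ s _ _) ⟩
      s * B L (ψ v) y + s * B L (π x) y
        ≡⟨ cong₂ _+_ (ψ-adjoint v y (pairings-∈ x)) (cong (λ z → s * B L (π x) z) (sym (⊕-⊖-cancelʳ y (ψ v′)))) ⟩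
      dot v v′ + s * B L (π x) (ψ v′ ⊕ π y)
        ≡⟨ cong (_+_ (dot v v′)) (trans (cong (s *_) (B-⊕ʳ L (π x) (ψ v′) (π y))) (ℤ.*-distribˡ-+ s _ _)) ⟩
      dot v v′ + (s * B L (π x) (ψ v′) + s * B L (π x) (π y))
        ≡⟨ cong (λ z → dot v v′ + (z + s * B L (π x) (π y))) (ψ-orthogonal-π x y) ⟩
      dot v v′ + (+ 0 + s * B L (π x) (π y))
        ≡⟨ cong (_+_ (dot v v′)) (ℤ.+-identityˡ _) ⟩
      dot v v′ + s * B L (π x) (π y)
        ≡⟨ cong (λ z → dot v v′ + s * z) (sym (trans (BG-pullback L embed-additive _ _) (cong₂ (B L) (embed-coords-π x) (embed-coords-π y)))) ⟩
      dot v v′ + s * B N (coords (π x)) (coords (π y)) ∎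
      where
      open ≡-Reasoning
      v v′ : Zn n
      v = pairings x
      v′ = pairings y

exactQuotient : (r : ℕ) .{{_ : ℕ.NonZero r}} → ℤ → ℤ
exactQuotient r (+ k)    = + (k ℕ./ r)
exactQuotient r -[1+ k ] = - + (suc k ℕ./ r)

exactQuotient-* : (r : ℕ) .{{_ : ℕ.NonZero r}} → ∀ z → exactQuotient r (+ r * z) ≡ z
exactQuotient-* r@(suc _) z = trans (cong (exactQuotient r) (ℤ.*-comm (+ r) z)) (exact z)
  where
  exact : ∀ z → exactQuotient r (z * + r) ≡ z
  exact (+ k)    rewrite sym (ℤ.pos-* k r) = cong +_ (ℕ.m*n/n≡m k r)
  exact -[1+ k ] rewrite sym (ℤ.neg-distribˡ-* (+ suc k) (+ r)) | sym (ℤ.pos-* (suc k) r) =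
    cong (λ q → - + q) (ℕ.m*n/n≡m (suc k) r)

map-exactQuotient : (r : ℕ) .{{_ : ℕ.NonZero r}} → (z : Zn n) → map (exactQuotient r) ((+ r) · z) ≡ z
map-exactQuotient r []      = refl
map-exactQuotient r (a ∷ z) = cong₂ _∷_ (exactQuotient-* r a) (map-exactQuotient r z)

-- With μ r = 4 and s μ = r, the map v ↦ S v / r embeds {v : P v} with the form (v·w)/s into L.
module _ (L : IntLattice m) {S : Zn n → Zn m} (S-additive : Additive S)
         (S-gram : ∀ a b → B L (S a) (S b) ≡ + 4 * dot a b) where

  splitOff-scaled : (μ : ℤ) .{{_ : ℤ.NonZero μ}} (r : ℕ) .{{_ : ℕ.NonZero r}} (s : ℤ) →
                     μ * + r ≡ + 4 → s * μ ≡ + r →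
                     (t : Fin n → Zn m) → (∀ i → μ · t i ≡ S (unit i)) →
                     (P : Zn n → Set) → (∀ v → P v → Σ (Zn m) λ z → (+ r) · z ≡ S v) →
                     (∀ x → P (pairings L t x)) →
                     Σ ℕ λ k → Σ (IntLattice k) λ N → IsometricPerp L n P s N
  splitOff-scaled μ r s μr≡4 sμ≡r t μt≡S P S-divisible pairings-∈ =
    splitOff L t t-nondegenerate t-orthogonal section
    where
    t-gram : ∀ i j → μ * (μ * B L (t i) (t j)) ≡ + 4 * dot (unit i) (unit j)
    t-gram i j = begin
      μ * (μ * B L (t i) (t j))     ≡⟨ cong (μ *_) (sym (B-·ʳ L μ (t i) (t j))) ⟩
      μ * B L (t i) (μ · t j)       ≡⟨ sym (B-·ˡ L μ (t i) (μ · t j)) ⟩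
      B L (μ · t i) (μ · t j)       ≡⟨ cong₂ (B L) (μt≡S i) (μt≡S j) ⟩
      B L (S (unit i)) (S (unit j)) ≡⟨ S-gram (unit i) (unit j) ⟩
      + 4 * dot (unit i) (unit j)   ∎
      where open ≡-Reasoning

    t-nondegenerate : ∀ i → B L (t i) (t i) ≢ + 0
    t-nondegenerate i tt≡0 = contradiction (begin
      + 4 * + 1                     ≡⟨ cong (+ 4 *_) (sym (trans (dot-unitʳ (unit i) i) (lookup-unit i))) ⟩
      + 4 * dot (unit i) (unit i)   ≡⟨ sym (t-gram i i) ⟩
      μ * (μ * B L (t i) (t i))     ≡⟨ cong (λ b → μ * (μ * b)) tt≡0 ⟩
      μ * (μ * + 0)                 ≡⟨ trans (cong (μ *_) (ℤ.*-zeroʳ μ)) (ℤ.*-zeroʳ μ) ⟩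
      + 0                           ∎) λ ()
      where open ≡-Reasoning

    t-orthogonal : ∀ i j → i ≢ j → B L (t i) (t j) ≡ + 0
    t-orthogonal i j i≢j =
      ℤ.*-cancelˡ-≡ μ _ _ (ℤ.*-cancelˡ-≡ μ _ _ (begin
        μ * (μ * B L (t i) (t j))   ≡⟨ t-gram i j ⟩
        + 4 * dot (unit i) (unit j) ≡⟨ cong (+ 4 *_) (trans (dot-unitʳ (unit i) j) (lookup-unit-≢ i j i≢j)) ⟩
        + 0                         ≡⟨ sym (ℤ.*-zeroʳ μ) ⟩
        μ * + 0                     ≡⟨ cong (μ *_) (sym (ℤ.*-zeroʳ μ)) ⟩
        μ * (μ * + 0)               ∎))
      where open ≡-Reasoning

    ψ : Zn n → Zn m
    ψ v = map (exactQuotient r) (S v)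

    r·ψ : ∀ v → P v → (+ r) · ψ v ≡ S v
    r·ψ v v∈ with S-divisible v v∈
    ... | z , rz≡Sv = trans (cong (λ u → (+ r) · map (exactQuotient r) u) (sym rz≡Sv))
                            (trans (cong ((+ r) ·_) (map-exactQuotient r z)) rz≡Sv)

    section : ScaledSection L t P s ψ
    section = record
      { pairings-∈ = pairings-∈
      ; ψ-additive = λ v v′ v∈ v′∈ v⊕v′∈ → ·-cancel (+ r) _ _ (begin
          (+ r) · ψ (v ⊕ v′)               ≡⟨ r·ψ (v ⊕ v′) v⊕v′∈ ⟩
          S (v ⊕ v′)                       ≡⟨ S-additive v v′ ⟩
          S v ⊕ S v′                       ≡⟨ sym (cong₂ _⊕_ (r·ψ v v∈) (r·ψ v′ v′∈)) ⟩
          ((+ r) · ψ v) ⊕ ((+ r) · ψ v′)   ≡⟨ sym (·-distrib-⊕ (+ r) (ψ v) (ψ v′)) ⟩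
          (+ r) · (ψ v ⊕ ψ v′)             ∎)
      ; pairings-ψ = λ v v∈ → lookup-ext λ i → trans (lookup∘tabulate _ i) (pairing-ψ v v∈ i)
      ; ψ-adjoint  = ψ-adjoint
      }
      where
      open ≡-Reasoning
      pairing-ψ : ∀ v → P v → ∀ i → B L (ψ v) (t i) ≡ lookup v i
      pairing-ψ v v∈ i = ℤ.*-cancelˡ-≡ (+ 4) _ _ (begin
        + 4 * B L (ψ v) (t i)           ≡⟨ cong (_* B L (ψ v) (t i)) (sym μr≡4) ⟩
        μ * + r * B L (ψ v) (t i)       ≡⟨ lemma μ (+ r) (B L (ψ v) (t i)) ⟩
        + r * (μ * B L (ψ v) (t i))     ≡⟨ cong (+ r *_) (sym (B-·ʳ L μ (ψ v) (t i))) ⟩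
        + r * B L (ψ v) (μ · t i)       ≡⟨ sym (B-·ˡ L (+ r) (ψ v) (μ · t i)) ⟩
        B L ((+ r) · ψ v) (μ · t i)     ≡⟨ cong₂ (B L) (r·ψ v v∈) (μt≡S i) ⟩
        B L (S v) (S (unit i))          ≡⟨ S-gram v (unit i) ⟩
        + 4 * dot v (unit i)            ≡⟨ cong (+ 4 *_) (dot-unitʳ v i) ⟩
        + 4 * lookup v i                ∎)
        where
        lemma : ∀ a b c → a * b * c ≡ b * (a * c)
        lemma = solve-∀
      ψ-adjoint : ∀ v z → P v → s * B L (ψ v) z ≡ dot v (pairings L t z)
      ψ-adjoint v z v∈ = ℤ.*-cancelˡ-≡ μ _ _ (begin
        μ * (s * B L (ψ v) z)                       ≡⟨ sym (ℤ.*-assoc μ s _) ⟩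
        μ * s * B L (ψ v) z                         ≡⟨ cong (_* B L (ψ v) z) (trans (ℤ.*-comm μ s) sμ≡r) ⟩
        + r * B L (ψ v) z                           ≡⟨ sym (B-·ˡ L (+ r) (ψ v) z) ⟩
        B L ((+ r) · ψ v) z                         ≡⟨ cong (λ u → B L u z) (r·ψ v v∈) ⟩
        B L (S v) z                                 ≡⟨ B-sym L (S v) z ⟩
        B L z (S v)                                 ≡⟨ additive-functional (λ u → B L z (S u))
                                                        (λ x y → trans (cong (B L z) (S-additive x y)) (B-⊕ʳ L z (S x) (S y))) v ⟩
        dot v (tabulate (λ i → B L z (S (unit i)))) ≡⟨ cong (dot v) (lookup-ext λ i → trans (lookup∘tabulate _ i) (pairing-S i)) ⟩
        dot v (μ · pairings L t z)                  ≡⟨ dot-·ʳ μ v (pairings L t z) ⟩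
        μ * dot v (pairings L t z)                  ∎)
        where
        pairing-S : ∀ i → B L z (S (unit i)) ≡ lookup (μ · pairings L t z) i
        pairing-S i = begin
          B L z (S (unit i))              ≡⟨ cong (B L z) (sym (μt≡S i)) ⟩
          B L z (μ · t i)                 ≡⟨ B-·ʳ L μ z (t i) ⟩
          μ * B L z (t i)                 ≡⟨ cong (μ *_) (sym (lookup∘tabulate _ i)) ⟩
          μ * lookup (pairings L t z) i   ≡⟨ sym (lookup-map i (μ *_) (pairings L t z)) ⟩
          lookup (μ · pairings L t z) i   ∎

-- Dₙ and its representations

sumℤ≡dot-1v : (a : Zn n) → sumℤ a ≡ dot a 1v
sumℤ≡dot-1v []      = refl
sumℤ≡dot-1v (x ∷ a) = cong₂ _+_ (sym (ℤ.*-identityʳ x)) (sumℤ≡dot-1v a)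

sumℤ-⊕ : (a b : Zn n) → sumℤ (a ⊕ b) ≡ sumℤ a + sumℤ b
sumℤ-⊕ a b = trans (sumℤ≡dot-1v (a ⊕ b)) (trans (dot-⊕ˡ a b 1v) (sym (cong₂ _+_ (sumℤ≡dot-1v a) (sumℤ≡dot-1v b))))

sumℤ-· : ∀ c (a : Zn n) → sumℤ (c · a) ≡ c * sumℤ a
sumℤ-· c a = trans (sumℤ≡dot-1v (c · a)) (trans (dot-·ˡ c a 1v) (cong (c *_) (sym (sumℤ≡dot-1v a))))

sumℤ-⊖ : (a b : Zn n) → sumℤ (a ⊖ b) ≡ sumℤ a - sumℤ b
sumℤ-⊖ a b = trans (sumℤ≡dot-1v (a ⊖ b)) (trans (dot-⊖ˡ a b 1v) (sym (cong₂ _-_ (sumℤ≡dot-1v a) (sumℤ≡dot-1v b))))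

sumℤ-unit : (i : Fin n) → sumℤ (unit i) ≡ + 1
sumℤ-unit i = trans (sumℤ≡dot-1v (unit i)) (trans (dot-comm (unit i) 1v) (trans (dot-unitʳ 1v i) (lookup-1v i)))

sumℤ-1v : ∀ n → sumℤ (1v {n}) ≡ + n
sumℤ-1v zero    = refl
sumℤ-1v (suc n) = trans (cong (_+_ (+ 1)) (sumℤ-1v n)) (sym (ℤ.pos-+ 1 n))

parity : ∀ z → Σ ℤ λ q → z ≡ q * + 2 ⊎ z ≡ q * + 2 + + 1
parity z with z % + 2 | n%d<d z (+ 2) | a≡a%n+[a/n]*n z (+ 2)
... | 0           | _                       | eq = z / + 2 , inj₁ (trans eq (ℤ.+-identityˡ _))
... | 1           | _                       | eq = z / + 2 , inj₂ (trans eq (ℤ.+-comm (+ 1) (z / + 2 * + 2)))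
... | suc (suc _) | ℕ.s≤s (ℕ.s≤s ())      | _

InD-intro : (a : Zn n) → + 2 Signed.∣ sumℤ a → InD a
InD-intro a = Signed.∣⇒∣ᵤ

InD-⊕ : (a b : Zn n) → InD a → InD b → InD (a ⊕ b)
InD-⊕ a b a∈ b∈ = InD-intro (a ⊕ b) (subst (+ 2 Signed.∣_) (sym (sumℤ-⊕ a b))
                    (Signed.∣m∣n⇒∣m+n (Signed.∣ᵤ⇒∣ {i = sumℤ a} a∈) (Signed.∣ᵤ⇒∣ {i = sumℤ b} b∈)))

InD-double : (a : Zn n) → InD (a ⊕ a)
InD-double a = InD-intro (a ⊕ a) (Signed.divides (sumℤ a) (trans (sumℤ-⊕ a a) (lemma (sumℤ a))))
  where
  lemma : ∀ x → x + x ≡ x * + 2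
  lemma = solve-∀

InD-unit-⊖-unit : (i j : Fin n) → InD (unit i ⊖ unit j)
InD-unit-⊖-unit i j = InD-intro (unit i ⊖ unit j)
  (Signed.divides (+ 0) (trans (sumℤ-⊖ (unit i) (unit j)) (cong₂ _-_ (sumℤ-unit i) (sumℤ-unit j))))

InD-or-InD-⊕-unit : (a : Zn n) (i : Fin n) → InD a ⊎ InD (a ⊕ unit i)
InD-or-InD-⊕-unit a i with parity (sumℤ a)
... | q , inj₁ even = inj₁ (InD-intro a (Signed.divides q even))
... | q , inj₂ odd  = inj₂ (InD-intro (a ⊕ unit i) (Signed.divides (q + + 1)
        (trans (sumℤ-⊕ a (unit i)) (trans (cong₂ _+_ odd (sumℤ-unit i)) (lemma q)))))
  where
  lemma : ∀ q → q * + 2 + + 1 + + 1 ≡ (q + + 1) * + 2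
  lemma = solve-∀

flip₀ : Zn (suc n) → Zn (suc n)
flip₀ (a ∷ v) = - a ∷ v

flip₀-additive : Additive (flip₀ {n})
flip₀-additive (a ∷ u) (b ∷ v) = cong (_∷ u ⊕ v) (ℤ.neg-distrib-+ a b)

dot-flip₀ : (a b : Zn (suc n)) → dot (flip₀ a) (flip₀ b) ≡ dot a b
dot-flip₀ (a ∷ u) (b ∷ v) = cong (_+ dot u v) (lemma a b)
  where
  lemma : ∀ a b → - a * - b ≡ a * b
  lemma = solve-∀

InD-flip₀ : (a : Zn (suc n)) → InD a → InD (flip₀ a)
InD-flip₀ (x ∷ a) x∷a∈ = InD-intro (flip₀ (x ∷ a))
  (subst (+ 2 Signed.∣_) (lemma x (sumℤ a))
    (Signed.∣m∣n⇒∣m-n (Signed.∣ᵤ⇒∣ {i = x + sumℤ a} x∷a∈) (Signed.divides x (ℤ.*-comm (+ 2) x))))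
  where
  lemma : ∀ x s → (x + s) - + 2 * x ≡ - x + s
  lemma = solve-∀

flip₀-1v : ∀ n → flip₀ (1v {suc n}) ≡ 1v ⊖ ((+ 2) · unit zero)
flip₀-1v n = cong (-[1+ 0 ] ∷_) (1v≡ n)
  where
  1v≡ : ∀ n → 1v {n} ≡ 1v ⊕ neg ((+ 2) · 0v)
  1v≡ zero    = refl
  1v≡ (suc n) = cong (+ 1 ∷_) (1v≡ n)

-- S a stands for σ(2a), for a representation σ of Dₙ: unlike σ it is additive on all of ℤⁿ.
record DnFrame (L : IntLattice m) (n : ℕ) : Set where
  field
    S          : Zn n → Zn m
    S-additive : Additive S
    S-gram     : ∀ a b → B L (S a) (S b) ≡ + 4 * dot a b
    S-half     : ∀ a → InD a → Σ (Zn m) λ z → (+ 2) · z ≡ S a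

DnFrame-flip₀ : {L : IntLattice m} → DnFrame L (suc n) → DnFrame L (suc n)
DnFrame-flip₀ F = record
  { S          = λ a → S (flip₀ a)
  ; S-additive = λ a b → trans (cong S (flip₀-additive a b)) (S-additive (flip₀ a) (flip₀ b))
  ; S-gram     = λ a b → trans (S-gram (flip₀ a) (flip₀ b)) (cong (+ 4 *_) (dot-flip₀ a b))
  ; S-half     = λ a a∈ → S-half (flip₀ a) (InD-flip₀ a a∈)
  }
  where open DnFrame F

module _ (L : IntLattice m) (σ : Rep n L) where

  Rep-polarised : ∀ u v → InD u → InD v → B L (map-σ σ u) (map-σ σ v) ≡ dot u v
  Rep-polarised u v u∈ v∈ = ℤ.*-cancelˡ-≡ (+ 2) _ _
    (∙-cancelˡ (dot u u) _ _ (∙-cancelʳ (dot v v) _ _ (begin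
      dot u u + + 2 * B L (σ′ u) (σ′ v) + dot v v
        ≡⟨ cong₂ (λ a b → a + + 2 * B L (σ′ u) (σ′ v) + b) (sym (isometric σ u u∈)) (sym (isometric σ v v∈)) ⟩
      B L (σ′ u) (σ′ u) + + 2 * B L (σ′ u) (σ′ v) + B L (σ′ v) (σ′ v)
        ≡⟨ sym (B-norm-⊕ L (σ′ u) (σ′ v)) ⟩
      B L (σ′ u ⊕ σ′ v) (σ′ u ⊕ σ′ v)
        ≡⟨ cong (λ z → B L z z) (sym (additive σ u v u∈ v∈)) ⟩
      B L (σ′ (u ⊕ v)) (σ′ (u ⊕ v))
        ≡⟨ isometric σ (u ⊕ v) (InD-⊕ u v u∈ v∈) ⟩
      dot (u ⊕ v) (u ⊕ v)
        ≡⟨ dot-norm-⊕ u v ⟩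
      dot u u + + 2 * dot u v + dot v v ∎)))
    where
    open ≡-Reasoning
    σ′ : Zn n → Zn m
    σ′ = map-σ σ

  Rep-half : ∀ a → InD a → (+ 2) · map-σ σ a ≡ map-σ σ (a ⊕ a)
  Rep-half a a∈ = trans (double (map-σ σ a)) (sym (additive σ a a a∈ a∈))
    where
    double : ∀ {m} (z : Zn m) → (+ 2) · z ≡ z ⊕ z
    double []      = refl
    double (x ∷ z) = cong₂ _∷_ (lemma x) (double z)
      where
      lemma : ∀ x → + 2 * x ≡ x + x
      lemma = solve-∀

  DnFrame-of-Rep : DnFrame L n
  DnFrame-of-Rep = record
    { S          = λ a → map-σ σ (a ⊕ a)
    ; S-additive = λ a b → trans (cong (map-σ σ) (interchange a b)) (additive σ (a ⊕ a) (b ⊕ b) (InD-double a) (InD-double b))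
    ; S-gram     = λ a b → trans (Rep-polarised (a ⊕ a) (b ⊕ b) (InD-double a) (InD-double b)) (dot-double a b)
    ; S-half     = λ a a∈ → map-σ σ a , Rep-half a a∈
    }
    where
    interchange : ∀ {n} (a b : Zn n) → (a ⊕ b) ⊕ (a ⊕ b) ≡ (a ⊕ a) ⊕ (b ⊕ b)
    interchange []      []      = refl
    interchange (x ∷ a) (y ∷ b) = cong₂ _∷_ (lemma x y) (interchange a b)
      where
      lemma : ∀ x y → (x + y) + (x + y) ≡ (x + x) + (y + y)
      lemma = solve-∀
    dot-double : ∀ a b → dot (a ⊕ a) (b ⊕ b) ≡ + 4 * dot a b
    dot-double a b = begin
      dot (a ⊕ a) (b ⊕ b)                      ≡⟨ dot-⊕ˡ a a (b ⊕ b) ⟩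
      dot a (b ⊕ b) + dot a (b ⊕ b)            ≡⟨ cong (λ z → z + z) (dot-⊕ʳ a b b) ⟩
      (dot a b + dot a b) + (dot a b + dot a b) ≡⟨ lemma (dot a b) ⟩
      + 4 * dot a b                            ∎
      where
      open ≡-Reasoning
      lemma : ∀ x → (x + x) + (x + x) ≡ + 4 * x
      lemma = solve-∀

module _ {L : IntLattice m} (F : DnFrame L n) where
  open DnFrame F

  half : ∀ a → InD a → Zn m
  half a a∈ = proj₁ (S-half a a∈)

  half-spec : ∀ a a∈ → (+ 2) · half a a∈ ≡ S a
  half-spec a a∈ = proj₂ (S-half a a∈)

  halfPairings : Fin n → Zn m → Zn n
  halfPairings i₀ x = tabulate (λ i → B L x (half (unit i ⊖ unit i₀) (InD-unit-⊖-unit i i₀)))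

  S-pairings-decomposition : ∀ i₀ x →
    pairings L (λ i → S (unit i)) x ≡ ((+ 2) · halfPairings i₀ x) ⊕ (B L x (S (unit i₀)) · 1v)
  S-pairings-decomposition i₀ x = lookup-ext λ i → begin
    lookup (pairings L (λ i → S (unit i)) x) i         ≡⟨ lookup∘tabulate _ i ⟩
    B L x (S (unit i))                                 ≡⟨ cong (B L x) (S-unit i) ⟩
    B L x (((+ 2) · z i) ⊕ S (unit i₀))                ≡⟨ B-⊕ʳ L x ((+ 2) · z i) (S (unit i₀)) ⟩
    B L x ((+ 2) · z i) + c                            ≡⟨ cong₂ _+_ (B-·ʳ L (+ 2) x (z i)) (sym (ℤ.*-identityʳ c)) ⟩
    + 2 * B L x (z i) + c * + 1                        ≡⟨ sym (cong₂ (λ p q → + 2 * p + c * q) (lookup∘tabulate _ i) (lookup-1v i)) ⟩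
    + 2 * lookup a i + c * lookup (1v {n}) i           ≡⟨ sym (cong₂ _+_ (lookup-map i (+ 2 *_) a) (lookup-map i (c *_) 1v)) ⟩
    lookup ((+ 2) · a) i + lookup (c · 1v) i           ≡⟨ sym (lookup-⊕ ((+ 2) · a) (c · 1v) i) ⟩
    lookup (((+ 2) · a) ⊕ (c · 1v)) i                  ∎
    where
    open ≡-Reasoning
    z : Fin n → Zn m
    z i = half (unit i ⊖ unit i₀) (InD-unit-⊖-unit i i₀)
    a : Zn n
    a = halfPairings i₀ x
    c : ℤ
    c = B L x (S (unit i₀))
    S-unit : ∀ i → S (unit i) ≡ ((+ 2) · z i) ⊕ S (unit i₀)
    S-unit i = begin
      S (unit i)                               ≡⟨ cong S (sym (⊖-⊕-cancel (unit i) (unit i₀))) ⟩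
      S ((unit i ⊖ unit i₀) ⊕ unit i₀)         ≡⟨ S-additive (unit i ⊖ unit i₀) (unit i₀) ⟩
      S (unit i ⊖ unit i₀) ⊕ S (unit i₀)       ≡⟨ cong (_⊕ S (unit i₀)) (sym (half-spec _ _)) ⟩
      ((+ 2) · z i) ⊕ S (unit i₀)              ∎

  splitOff-Iₙ : (i₀ : Fin n) (v : Zn m) → (+ 2) · v ≡ S (unit i₀) →
           Σ ℕ λ k → Σ (IntLattice k) λ N → IsoIPerp L n N
  splitOff-Iₙ i₀ v 2v≡S = splitOff-scaled L S-additive S-gram (+ 2) 2 (+ 1) refl refl t 2t≡S
                       (λ _ → ⊤) divisible (λ _ → tt)
    where
    t : Fin n → Zn m
    t i = v ⊖ half (unit i₀ ⊖ unit i) (InD-unit-⊖-unit i₀ i)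

    2t≡S : ∀ i → (+ 2) · t i ≡ S (unit i)
    2t≡S i = begin
      (+ 2) · t i                              ≡⟨ ·-distrib-⊖ (+ 2) v _ ⟩
      ((+ 2) · v) ⊖ ((+ 2) · half _ _)         ≡⟨ cong₂ _⊖_ 2v≡S (half-spec _ _) ⟩
      S (unit i₀) ⊖ S (unit i₀ ⊖ unit i)       ≡⟨ cong (_⊖_ (S (unit i₀))) (additive-⊖ S-additive (unit i₀) (unit i)) ⟩
      S (unit i₀) ⊖ (S (unit i₀) ⊖ S (unit i)) ≡⟨ ⊖-⊖-cancel (S (unit i₀)) (S (unit i)) ⟩
      S (unit i)                               ∎
      where open ≡-Reasoning

    divisible : ∀ u → ⊤ → Σ (Zn m) λ z → (+ 2) · z ≡ S u
    divisible u _ = combination t u , sym (additive-unique S-additive 2·combination-additive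
                      (λ i → trans (sym (2t≡S i)) (cong ((+ 2) ·_) (sym (combination-unit t i)))) u)
      where
      2·combination-additive : Additive (λ u → (+ 2) · combination t u)
      2·combination-additive x y =
        trans (cong ((+ 2) ·_) (combination-additive t x y)) (·-distrib-⊕ (+ 2) (combination t x) (combination t y))

  splitOff-Dₙ[1] : (i₀ : Fin n) (w : Zn m) → (+ 4) · w ≡ S 1v →
           Σ ℕ λ k → Σ (IntLattice k) λ N → IsoDn1Perp L n N
  splitOff-Dₙ[1] i₀ w 4w≡S = splitOff-scaled L S-additive S-gram (+ 1) 4 (+ 4) refl refl t (λ i → ·-identityˡ (t i))
                       InDn1 divisible pairings-∈
    where
    open ≡-Reasoning

    t : Fin n → Zn m
    t i = S (unit i)

    divisible : ∀ u → InDn1 u → Σ (Zn m) λ z → (+ 4) · z ≡ S u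
    divisible u (a , c , a∈ , u≡2a+c1) = (half a a∈ ⊕ (c · w)) , (begin
      (+ 4) · (half a a∈ ⊕ (c · w))                        ≡⟨ ·-distrib-⊕ (+ 4) (half a a∈) (c · w) ⟩
      ((+ 4) · half a a∈) ⊕ ((+ 4) · (c · w))              ≡⟨ cong₂ _⊕_ (sym (·-assoc (+ 2) (+ 2) (half a a∈))) (·-comm (+ 4) c w) ⟩
      ((+ 2) · ((+ 2) · half a a∈)) ⊕ (c · ((+ 4) · w))    ≡⟨ cong₂ (λ x y → ((+ 2) · x) ⊕ (c · y)) (half-spec a a∈) 4w≡S ⟩
      ((+ 2) · S a) ⊕ (c · S 1v)                           ≡⟨ sym (cong₂ _⊕_ (additive-· S-additive (+ 2) a) (additive-· S-additive c 1v)) ⟩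
      S ((+ 2) · a) ⊕ S (c · 1v)                           ≡⟨ sym (S-additive ((+ 2) · a) (c · 1v)) ⟩
      S (((+ 2) · a) ⊕ (c · 1v))                           ≡⟨ cong S (sym u≡2a+c1) ⟩
      S u                                                  ∎)

    4·norm-w : + 4 * B L w w ≡ + n
    4·norm-w = ℤ.*-cancelˡ-≡ (+ 4) _ _ (begin
      + 4 * (+ 4 * B L w w)        ≡⟨ cong (+ 4 *_) (sym (B-·ʳ L (+ 4) w w)) ⟩
      + 4 * B L w ((+ 4) · w)      ≡⟨ sym (B-·ˡ L (+ 4) w ((+ 4) · w)) ⟩
      B L ((+ 4) · w) ((+ 4) · w)  ≡⟨ cong₂ (B L) 4w≡S 4w≡S ⟩
      B L (S 1v) (S 1v)            ≡⟨ S-gram 1v 1v ⟩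
      + 4 * dot (1v {n}) 1v        ≡⟨ cong (+ 4 *_) (trans (sym (sumℤ≡dot-1v (1v {n}))) (sumℤ-1v n)) ⟩
      + 4 * + n                    ∎)

    pairings-∈ : ∀ x → InDn1 (pairings L t x)
    pairings-∈ x = a , c , a∈ , pairings≡2a+c1
      where
      a : Zn n
      a = halfPairings i₀ x
      c : ℤ
      c = B L x (S (unit i₀))
      pairings≡2a+c1 : pairings L t x ≡ ((+ 2) · a) ⊕ (c · 1v)
      pairings≡2a+c1 = S-pairings-decomposition i₀ x
      sum-pairings : sumℤ (pairings L t x) ≡ + 4 * B L x w
      sum-pairings = begin
        sumℤ (pairings L t x)      ≡⟨ trans (sumℤ≡dot-1v (pairings L t x)) (dot-comm (pairings L t x) 1v) ⟩
        dot 1v (pairings L t x)    ≡⟨ sym (additive-functional (λ u → B L x (S u))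
                                        (λ u v → trans (cong (B L x) (S-additive u v)) (B-⊕ʳ L x (S u) (S v))) 1v) ⟩
        B L x (S 1v)               ≡⟨ cong (B L x) (sym 4w≡S) ⟩
        B L x ((+ 4) · w)          ≡⟨ B-·ʳ L (+ 4) x w ⟩
        + 4 * B L x w              ∎

      2·sum-a : + 2 * sumℤ a ≡ + 2 * ((B L x w - c * B L w w) * + 2)
      2·sum-a = begin
        + 2 * sumℤ a                                               ≡⟨ lemma₁ (+ 2 * sumℤ a) (c * + n) ⟩
        (+ 2 * sumℤ a + c * + n) - c * + n                         ≡⟨ cong₂ (λ p q → (p + q) - c * + n) (sym (sumℤ-· (+ 2) a))
                                                                        (cong (c *_) (sym (sumℤ-1v n))) ⟩
        (sumℤ ((+ 2) · a) + c * sumℤ (1v {n})) - c * + n           ≡⟨ cong (λ p → (sumℤ ((+ 2) · a) + p) - c * + n) (sym (sumℤ-· c (1v {n}))) ⟩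
        (sumℤ ((+ 2) · a) + sumℤ (c · 1v {n})) - c * + n            ≡⟨ cong (_- c * + n) (sym (sumℤ-⊕ ((+ 2) · a) (c · 1v {n}))) ⟩
        sumℤ (((+ 2) · a) ⊕ (c · 1v {n})) - c * + n                 ≡⟨ cong₂ (λ p q → sumℤ p - c * q) (sym pairings≡2a+c1) (sym 4·norm-w) ⟩
        sumℤ (pairings L t x) - c * (+ 4 * B L w w)                ≡⟨ cong (_- c * (+ 4 * B L w w)) sum-pairings ⟩
        + 4 * B L x w - c * (+ 4 * B L w w)                        ≡⟨ lemma₂ (B L x w) c (B L w w) ⟩
        + 2 * ((B L x w - c * B L w w) * + 2)                      ∎
        where
        lemma₁ : ∀ p q → p ≡ (p + q) - q
        lemma₁ = solve-∀
        lemma₂ : ∀ b c r → + 4 * b - c * (+ 4 * r) ≡ + 2 * ((b - c * r) * + 2)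
        lemma₂ = solve-∀

      a∈ : InD a
      a∈ = InD-intro a (Signed.divides (B L x w - c * B L w w) (ℤ.*-cancelˡ-≡ (+ 2) _ _ 2·sum-a))

Splitting : IntLattice m → ℕ → Set
Splitting L n = Σ ℕ λ k → Σ (IntLattice k) λ N → IsoIPerp L n N ⊎ IsoDn1Perp L n N

module _ {L : IntLattice m} (σ : Rep n L) where
  open DnFrame (DnFrame-of-Rep L σ)

  4·y≡S-pairings : (y : Zn m) (d : ℕ) .{{_ : ℕ.NonZero d}} (x : Zn n) → InD x → (+ d) · y ≡ map-σ σ x →
                   (+ 4) · y ≡ S (pairings L (λ i → S (unit i)) y)
  4·y≡S-pairings y d x x∈ dy≡σx = ·-cancel (+ d) _ _ (begin
    (+ d) · ((+ 4) · y)            ≡⟨ ·-comm (+ d) (+ 4) y ⟩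
    (+ 4) · ((+ d) · y)            ≡⟨ sym (·-assoc (+ 2) (+ 2) ((+ d) · y)) ⟩
    (+ 2) · ((+ 2) · ((+ d) · y))  ≡⟨ cong (λ z → (+ 2) · ((+ 2) · z)) dy≡σx ⟩
    (+ 2) · ((+ 2) · map-σ σ x)    ≡⟨ cong ((+ 2) ·_) (Rep-half L σ x x∈) ⟩
    (+ 2) · S x                    ≡⟨ sym (additive-· S-additive (+ 2) x) ⟩
    S ((+ 2) · x)                  ≡⟨ cong S (sym d·τ≡2x) ⟩
    S ((+ d) · τ)                  ≡⟨ additive-· S-additive (+ d) τ ⟩
    (+ d) · S τ                    ∎)
    where
    open ≡-Reasoning
    τ : Zn n
    τ = pairings L (λ i → S (unit i)) y
    d·τ≡2x : (+ d) · τ ≡ (+ 2) · x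
    d·τ≡2x = lookup-ext λ i → begin
      lookup ((+ d) · τ) i             ≡⟨ trans (lookup-map i (+ d *_) τ) (cong (+ d *_) (lookup∘tabulate _ i)) ⟩
      + d * B L y (S (unit i))         ≡⟨ ℤ.*-cancelˡ-≡ (+ 2) _ _ (begin
        + 2 * (+ d * B L y (S (unit i)))    ≡⟨ cong (+ 2 *_) (sym (B-·ˡ L (+ d) y (S (unit i)))) ⟩
        + 2 * B L ((+ d) · y) (S (unit i))  ≡⟨ sym (B-·ˡ L (+ 2) ((+ d) · y) (S (unit i))) ⟩
        B L ((+ 2) · ((+ d) · y)) (S (unit i)) ≡⟨ cong (λ z → B L ((+ 2) · z) (S (unit i))) dy≡σx ⟩
        B L ((+ 2) · map-σ σ x) (S (unit i)) ≡⟨ cong (λ z → B L z (S (unit i))) (Rep-half L σ x x∈) ⟩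
        B L (S x) (S (unit i))              ≡⟨ S-gram x (unit i) ⟩
        + 4 * dot x (unit i)                ≡⟨ cong (+ 4 *_) (dot-unitʳ x i) ⟩
        + 4 * lookup x i                    ≡⟨ ℤ.*-assoc (+ 2) (+ 2) (lookup x i) ⟩
        + 2 * (+ 2 * lookup x i)            ∎) ⟩
      + 2 * lookup x i                 ≡⟨ sym (lookup-map i (+ 2 *_) x) ⟩
      lookup ((+ 2) · x) i             ∎

private
  even-shape : ∀ q (a : Zn n) → ((+ 2) · a) ⊕ ((q * + 2) · 1v) ≡ (+ 2) · (a ⊕ (q · 1v))
  even-shape q []      = refl
  even-shape q (x ∷ a) = cong₂ _∷_ (lemma q x) (even-shape q a)
    where
    lemma : ∀ q x → + 2 * x + q * + 2 * + 1 ≡ + 2 * (x + q * + 1)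
    lemma = solve-∀

  odd-shape : ∀ q (a : Zn n) → ((+ 2) · a) ⊕ ((q * + 2 + + 1) · 1v) ≡ ((+ 2) · (a ⊕ (q · 1v))) ⊕ 1v
  odd-shape q []      = refl
  odd-shape q (x ∷ a) = cong₂ _∷_ (lemma q x) (odd-shape q a)
    where
    lemma : ∀ q x → + 2 * x + (q * + 2 + + 1) * + 1 ≡ + 2 * (x + q * + 1) + + 1
    lemma = solve-∀

module _ {L : IntLattice m} (σ : Rep (suc n) L) where
  private
    F : DnFrame L (suc n)
    F = DnFrame-of-Rep L σ

  open DnFrame F

  private
    σ′ : Zn (suc n) → Zn m
    σ′ = map-σ σ

    4·[y⊖σz] : ∀ y z → InD z → (+ 4) · (y ⊖ σ′ z) ≡ ((+ 4) · y) ⊖ ((+ 2) · S z)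
    4·[y⊖σz] y z z∈ = begin
      (+ 4) · (y ⊖ σ′ z)                     ≡⟨ ·-distrib-⊖ (+ 4) y (σ′ z) ⟩
      ((+ 4) · y) ⊖ ((+ 4) · σ′ z)           ≡⟨ cong (((+ 4) · y) ⊖_) (sym (·-assoc (+ 2) (+ 2) (σ′ z))) ⟩
      ((+ 4) · y) ⊖ ((+ 2) · ((+ 2) · σ′ z)) ≡⟨ cong (λ u → ((+ 4) · y) ⊖ ((+ 2) · u)) (Rep-half L σ z z∈) ⟩
      ((+ 4) · y) ⊖ ((+ 2) · S z)            ∎
      where open ≡-Reasoning

  splitting-even : (y : Zn m) (s : Zn (suc n)) → (+ 2) · y ≡ S s →
                   ¬ (Σ (Zn (suc n)) λ x′ → InD x′ × σ′ x′ ≡ y) → Splitting L (suc n)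
  splitting-even y s 2y≡Ss y∉σD with InD-or-InD-⊕-unit s zero
  ... | inj₁ s∈  = contradiction (s , s∈ , ·-cancel (+ 2) _ _ (trans (Rep-half L σ s s∈) (sym 2y≡Ss))) y∉σD
  ... | inj₂ s′∈ = map₂ (map₂ inj₁) (splitOff-Iₙ F zero (σ′ (s ⊕ unit zero) ⊖ y) (begin
    (+ 2) · (σ′ (s ⊕ unit zero) ⊖ y)               ≡⟨ ·-distrib-⊖ (+ 2) (σ′ (s ⊕ unit zero)) y ⟩
    ((+ 2) · σ′ (s ⊕ unit zero)) ⊖ ((+ 2) · y)     ≡⟨ cong₂ _⊖_ (Rep-half L σ (s ⊕ unit zero) s′∈) 2y≡Ss ⟩
    S (s ⊕ unit zero) ⊖ S s                        ≡⟨ cong (_⊖ S s) (S-additive s (unit zero)) ⟩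
    (S s ⊕ S (unit zero)) ⊖ S s                    ≡⟨ ⊕-⊖-cancelˡ (S s) (S (unit zero)) ⟩
    S (unit zero)                                  ∎))
    where open ≡-Reasoning

  splitting-odd : (y : Zn m) (s : Zn (suc n)) → (+ 4) · y ≡ ((+ 2) · S s) ⊕ S 1v → Splitting L (suc n)
  splitting-odd y s 4y≡2Ss⊕S1 with InD-or-InD-⊕-unit s zero
  ... | inj₁ s∈  = map₂ (map₂ inj₂) (splitOff-Dₙ[1] F zero (y ⊖ σ′ s) (begin
    (+ 4) · (y ⊖ σ′ s)                         ≡⟨ 4·[y⊖σz] y s s∈ ⟩
    ((+ 4) · y) ⊖ ((+ 2) · S s)                ≡⟨ cong (_⊖ ((+ 2) · S s)) 4y≡2Ss⊕S1 ⟩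
    (((+ 2) · S s) ⊕ S 1v) ⊖ ((+ 2) · S s)     ≡⟨ ⊕-⊖-cancelˡ ((+ 2) · S s) (S 1v) ⟩
    S 1v                                       ∎))
    where open ≡-Reasoning
  ... | inj₂ s′∈ = map₂ (map₂ inj₂) (splitOff-Dₙ[1] (DnFrame-flip₀ F) zero (y ⊖ σ′ (s ⊕ unit zero)) (begin
    (+ 4) · (y ⊖ σ′ (s ⊕ unit zero))                         ≡⟨ 4·[y⊖σz] y (s ⊕ unit zero) s′∈ ⟩
    ((+ 4) · y) ⊖ ((+ 2) · S (s ⊕ unit zero))                ≡⟨ cong₂ (λ u v → u ⊖ ((+ 2) · v)) 4y≡2Ss⊕S1 (S-additive s (unit zero)) ⟩
    (2Ss ⊕ S 1v) ⊖ ((+ 2) · (S s ⊕ S (unit zero)))           ≡⟨ cong ((2Ss ⊕ S 1v) ⊖_) (·-distrib-⊕ (+ 2) (S s) (S (unit zero))) ⟩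
    (2Ss ⊕ S 1v) ⊖ (2Ss ⊕ ((+ 2) · S (unit zero)))           ≡⟨ ⊕-⊖-interchange 2Ss (S 1v) 2Ss ((+ 2) · S (unit zero)) ⟩
    (2Ss ⊖ 2Ss) ⊕ (S 1v ⊖ ((+ 2) · S (unit zero)))           ≡⟨ cong (_⊕ (S 1v ⊖ ((+ 2) · S (unit zero)))) (⊖-self 2Ss) ⟩
    0v ⊕ (S 1v ⊖ ((+ 2) · S (unit zero)))                    ≡⟨ ⊕-identityˡ (S 1v ⊖ ((+ 2) · S (unit zero))) ⟩
    S 1v ⊖ ((+ 2) · S (unit zero))                           ≡⟨ cong (S 1v ⊖_) (sym (additive-· S-additive (+ 2) (unit zero))) ⟩
    S 1v ⊖ S ((+ 2) · unit zero)                             ≡⟨ sym (additive-⊖ S-additive 1v ((+ 2) · unit zero)) ⟩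
    S (1v ⊖ ((+ 2) · unit zero))                             ≡⟨ cong S (sym (flip₀-1v n)) ⟩
    S (flip₀ 1v)                                             ∎))
    where
    open ≡-Reasoning
    2Ss : Zn m
    2Ss = (+ 2) · S s

  splitting : (y : Zn m) (d : ℕ) .{{_ : ℕ.NonZero d}} (x : Zn (suc n)) → InD x → (+ d) · y ≡ σ′ x →
              ¬ (Σ (Zn (suc n)) λ x′ → InD x′ × σ′ x′ ≡ y) → Splitting L (suc n)
  splitting y d x x∈ dy≡σx y∉σD = byParity (parity c)
    where
    open ≡-Reasoning
    a : Zn (suc n)
    a = halfPairings F zero y
    c : ℤ
    c = B L y (S (unit zero))
    4y≡S[2a+c1] : (+ 4) · y ≡ S (((+ 2) · a) ⊕ (c · 1v))
    4y≡S[2a+c1] = trans (4·y≡S-pairings σ y d x x∈ dy≡σx) (cong S (S-pairings-decomposition F zero y))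
    byParity : (Σ ℤ λ q → c ≡ q * + 2 ⊎ c ≡ q * + 2 + + 1) → Splitting L (suc n)
    byParity (q , inj₁ c≡2q) = splitting-even y (a ⊕ (q · 1v)) (·-cancel (+ 2) _ _ (begin
      (+ 2) · ((+ 2) · y)            ≡⟨ ·-assoc (+ 2) (+ 2) y ⟩
      (+ 4) · y                      ≡⟨ 4y≡S[2a+c1] ⟩
      S (((+ 2) · a) ⊕ (c · 1v))     ≡⟨ cong S (trans (cong (λ c → ((+ 2) · a) ⊕ (c · 1v)) c≡2q) (even-shape q a)) ⟩
      S ((+ 2) · (a ⊕ (q · 1v)))     ≡⟨ additive-· S-additive (+ 2) (a ⊕ (q · 1v)) ⟩
      (+ 2) · S (a ⊕ (q · 1v))       ∎)) y∉σD
    byParity (q , inj₂ c≡2q+1) = splitting-odd y (a ⊕ (q · 1v)) (begin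
      (+ 4) · y                                  ≡⟨ 4y≡S[2a+c1] ⟩
      S (((+ 2) · a) ⊕ (c · 1v))                 ≡⟨ cong S (trans (cong (λ c → ((+ 2) · a) ⊕ (c · 1v)) c≡2q+1) (odd-shape q a)) ⟩
      S (((+ 2) · (a ⊕ (q · 1v))) ⊕ 1v)          ≡⟨ S-additive ((+ 2) · (a ⊕ (q · 1v))) 1v ⟩
      S ((+ 2) · (a ⊕ (q · 1v))) ⊕ S 1v          ≡⟨ cong (_⊕ S 1v) (additive-· S-additive (+ 2) (a ⊕ (q · 1v))) ⟩
      ((+ 2) · S (a ⊕ (q · 1v))) ⊕ S 1v          ∎)

-- The bound 4 ≤ n is only used to know that n is positive.
lemma3p1 : (n : ℕ) → 4 ≤ n → {m : ℕ} (L : IntLattice m) (σ : Rep n L) → Imprimitive σ →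
             Σ ℕ λ k → Σ (IntLattice k) λ N → IsoIPerp L n N ⊎ IsoDn1Perp L n N
lemma3p1 (suc n) _ L σ (y , suc d , x , _ , x∈ , dy≡σx , y∉σD) = splitting σ y (suc d) x x∈ dy≡σx y∉σD
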